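{- For all integers $j\geq 0$ and all integers $n\geq 0$, $$a_{5j+5}(5n+3)\equiv 0 \pmod{5}.$$
   Context: For a fixed integer $k\geq 1$, $a_k(n)$ denotes the number of partitions of $n$ in which even parts come in only one color while odd parts may appear in one of $k$ colors. Equivalently, $$\sum_{n\geq 0} a_k(n)q^n=\frac{1}{(q^2;q^2)_\infty (q;q^2)_\infty^k}=\frac{f_2^{k-1}}{f_1^k},$$ where $f_m=(q^m;q^m)_\infty=\prod_{i\geq 1}(1-q^{mi})$. -}

module Defs where

open import Data.Nat using (ℕ; zero; suc; _+_; _∸_; _≤ᵇ_)
open import Data.Nat using (_%_; _≡ᵇ_)
open import Data.Bool using (Bool; true; false; if_then_else_)
open import Data.List using (List; []; _∷_; _++_; replicate; upTo; concatMap; map)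

-- Part "kinds" available for partitions of n into parts of size ≤ n:
-- each even size i ∈ [1, n] is one kind (one colour);
-- each odd size i ∈ [1, n] contributes k distinct kinds (k colours).
kinds : ℕ → ℕ → List ℕ
kinds k n = concatMap (λ i → if (i % 2) ≡ᵇ 0 then i ∷ [] else replicate k i)
                      (map suc (upTo n))

-- ways ws r  = number of multisets of kinds from ws (kinds are distinguished
-- by their position in ws) whose sizes sum to r.
mutual
  ways : List ℕ → ℕ → ℕ
  ways [] zero = 1
  ways [] (suc _) = 0
  ways (w ∷ ws) r = useW r w ws r

  -- useW f w ws r : choose how many copies of the kind w to use (at most f
  -- copies; f = r suffices as all sizes are ≥ 1), then recurse on ws.
  useW : ℕ → ℕ → List ℕ → ℕ → ℕ
  useW zero w ws r = ways ws r
  useW (suc f) zero ws r = ways ws r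
  useW (suc f) (suc w') ws r =
    ways ws r + (if suc w' ≤ᵇ r then useW f (suc w') ws (r ∸ suc w') else 0)

-- a k n : number of partitions of n in which even parts come in one colour
-- and odd parts come in one of k colours.
a : ℕ → ℕ → ℕ
a k n = ways (kinds k n) n

{-# OPTIONS --safe #-}
module Submission where

-- Let E and O be the products of 1 - qⁱ over even and over odd i, so that the generating
-- function of a_k is 1 / (E Oᵏ) = E⁹ · 1 / (E¹⁰ Oᵏ).  Modulo 5, (1 - qⁱ)⁵ ≡ 1 - q⁵ⁱ, so for
-- k = 5(j + 1) the denominator E¹⁰ Oᵏ is a product of factors 1 - q⁵ⁱ and the second factor is a
-- series in q⁵.  By Jacobi's identity (q;q)³ = ∑ (-1)ᵐ (2m + 1) q^(m(m+1)/2), and a triangular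
-- number is ≡ 0, 1 or 3 (mod 5), the last only when m ≡ 2, where 5 ∣ 2m + 1.  Hence modulo 5
-- the coefficients of E³ (a series in q²) vanish outside exponents ≡ 0, 2, those of E⁹ = (E³)³
-- vanish at exponents ≡ 3, and so do those of E⁹ times a series in q⁵.
--
-- All products are compared below a fixed degree.  Jacobi's identity comes from the finite triple
-- product P_N(z) = z^N ∏_{n=1}^{N} (1 - z xⁿ)(1 - z⁻¹ xⁿ⁻¹), whose coefficients are signed Gaussian
-- binomials: P_N(1) = 0 and P_N′(1) = (x;x)_N (x;x)_{N-1}, and after multiplying by (x;x)_{2N}
-- each Gaussian binomial becomes 1 up to degree N.

open import Level using (0ℓ)
open import Algebra.Bundles using (CommutativeRing)
open import Algebra.Structures using (IsCommutativeRing)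
import Algebra.Properties.CommutativeSemigroup as CommutativeSemigroupProperties
import Algebra.Properties.CommutativeSemiring.Exp as CommutativeSemiringExp
import Algebra.Properties.Monoid.Mult.TCOptimised as MultOptimised
import Algebra.Properties.Ring as RingProperties
import Algebra.Properties.Semiring.Exp as SemiringExp
import Algebra.Properties.Semiring.Mult as SemiringMult
import Algebra.Solver.Ring.NaturalCoefficients.Default as NaturalSolver
open import Data.Bool using (true; false; if_then_else_; T)
open import Data.Integer as ℤ using (ℤ; +_)
import Data.Integer.Properties as ℤ
import Data.Integer.Divisibility.Signed as ℤ∣
open import Data.Integer.Tactic.RingSolver using () renaming (solve-∀ to solve-∀-ℤ)
open import Data.List using (List; []; _∷_; _++_; map; concatMap; replicate; upTo; applyUpTo)
open import Data.List.Relation.Unary.All using (All; []; _∷_)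
open import Data.List.Relation.Unary.All.Properties using (concat⁺; map⁺; applyUpTo⁺₂; replicate⁺)
open import Data.Nat as ℕ using (ℕ; zero; suc; _≤_; _<_; z≤n; s≤s; _∸_; _%_; _/_; _≤ᵇ_; _≡ᵇ_)
import Data.Nat.Properties as ℕ
open import Data.Nat.Divisibility using (_∣_; _∣0; m∣m*n; n∣m⇒m%n≡0; ∣m∸n∣n⇒∣m)
open import Data.Nat.DivMod using (m≡m%n+[m/n]*n; [m+kn]%n≡m%n; %-distribˡ-+; %-distribˡ-*; m%n<n; m*n%n≡0)
open import Data.Nat.Induction using (<-rec)
open import Data.Nat.Tactic.RingSolver using (solve-∀)
open import Data.Product using (_,_)
open import Data.Sum using (_⊎_; inj₁; inj₂)
open import Function using (_∘_; id)
open import Relation.Binary.Bundles using (Setoid)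
open import Relation.Binary.PropositionalEquality as ≡ using (_≡_; _≢_)
import Relation.Binary.Reasoning.Setoid as SetoidReasoning
open import Relation.Nullary using (¬_; yes; no; map′; contradiction)
open import Relation.Unary using (Decidable)
open import Defs

module IntegersModulo (m : ℕ) where

  open ℤ∣ using (divides; ∣m⇒∣-m; ∣m∣n⇒∣m+n; ∣m⇒∣m*n; ∣n⇒∣m*n; ∣⇒∣ᵤ)

  infix 4 _≈_
  record _≈_ (x y : ℤ) : Set where
    constructor congruent
    field divides-difference : + m ℤ∣.∣ x ℤ.- y

  private
    x-x≡0 : ∀ x → + 0 ≡ x ℤ.- x
    x-x≡0 = solve-∀-ℤ
    neg-difference : ∀ x y → ℤ.- (x ℤ.- y) ≡ y ℤ.- x
    neg-difference = solve-∀-ℤ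
    difference-trans : ∀ x y z → (x ℤ.- y) ℤ.+ (y ℤ.- z) ≡ x ℤ.- z
    difference-trans = solve-∀-ℤ
    difference-+ : ∀ x y u v → (x ℤ.- y) ℤ.+ (u ℤ.- v) ≡ (x ℤ.+ u) ℤ.- (y ℤ.+ v)
    difference-+ = solve-∀-ℤ
    difference-* : ∀ x y u v → (x ℤ.- y) ℤ.* u ℤ.+ y ℤ.* (u ℤ.- v) ≡ x ℤ.* u ℤ.- y ℤ.* v
    difference-* = solve-∀-ℤ
    difference-neg : ∀ x y → ℤ.- (x ℤ.- y) ≡ ℤ.- x ℤ.- ℤ.- y
    difference-neg = solve-∀-ℤ

    resp : ∀ {z u v} → z ≡ u ℤ.- v → + m ℤ∣.∣ z → u ≈ v
    resp eq p = congruent (≡.subst (+ m ℤ∣.∣_) eq p)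

    ≈-reflexive : ∀ {x y} → x ≡ y → x ≈ y
    ≈-reflexive {x} ≡.refl = resp (x-x≡0 x) (divides (+ 0) ≡.refl)

    ≈-sym : ∀ {x y} → x ≈ y → y ≈ x
    ≈-sym {x} {y} (congruent p) = resp (neg-difference x y) (∣m⇒∣-m p)

    ≈-trans : ∀ {x y z} → x ≈ y → y ≈ z → x ≈ z
    ≈-trans {x} {y} {z} (congruent p) (congruent q) = resp (difference-trans x y z) (∣m∣n⇒∣m+n p q)

    +-cong : ∀ {x y u v} → x ≈ y → u ≈ v → x ℤ.+ u ≈ y ℤ.+ v
    +-cong {x} {y} {u} {v} (congruent p) (congruent q) = resp (difference-+ x y u v) (∣m∣n⇒∣m+n p q)

    *-cong : ∀ {x y u v} → x ≈ y → u ≈ v → x ℤ.* u ≈ y ℤ.* v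
    *-cong {x} {y} {u} {v} (congruent p) (congruent q) =
      resp (difference-* x y u v) (∣m∣n⇒∣m+n (∣m⇒∣m*n u p) (∣n⇒∣m*n y q))

    -‿cong : ∀ {x y} → x ≈ y → ℤ.- x ≈ ℤ.- y
    -‿cong {x} {y} (congruent p) = resp (difference-neg x y) (∣m⇒∣-m p)

  isCommutativeRing : IsCommutativeRing _≈_ ℤ._+_ ℤ._*_ ℤ.-_ (+ 0) (+ 1)
  isCommutativeRing = record
    { isRing = record
      { +-isAbelianGroup = record
        { isGroup = record
          { isMonoid = record
            { isSemigroup = record
              { isMagma = record
                { isEquivalence = record { refl = ≈-reflexive ≡.refl ; sym = ≈-sym ; trans = ≈-trans }
                ; ∙-cong = +-cong }
              ; assoc = λ x y z → ≈-reflexive (ℤ.+-assoc x y z) }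
            ; identity = (λ x → ≈-reflexive (ℤ.+-identityˡ x)) , (λ x → ≈-reflexive (ℤ.+-identityʳ x)) }
          ; inverse = (λ x → ≈-reflexive (ℤ.+-inverseˡ x)) , (λ x → ≈-reflexive (ℤ.+-inverseʳ x))
          ; ⁻¹-cong = -‿cong }
        ; comm = λ x y → ≈-reflexive (ℤ.+-comm x y) }
      ; *-cong = *-cong
      ; *-assoc = λ x y z → ≈-reflexive (ℤ.*-assoc x y z)
      ; *-identity = (λ x → ≈-reflexive (ℤ.*-identityˡ x)) , (λ x → ≈-reflexive (ℤ.*-identityʳ x))
      ; distrib = (λ x y z → ≈-reflexive (ℤ.*-distribˡ-+ x y z)) , (λ x y z → ≈-reflexive (ℤ.*-distribʳ-+ x y z)) }
    ; *-comm = λ x y → ≈-reflexive (ℤ.*-comm x y) }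

  ring : CommutativeRing 0ℓ 0ℓ
  ring = record { isCommutativeRing = isCommutativeRing }

  open SemiringMult (CommutativeRing.semiring ring) using (_×_)

  n×1≡+n : ∀ n → n × + 1 ≡ + n
  n×1≡+n zero = ≡.refl
  n×1≡+n (suc n) = ≡.cong (ℤ._+_ (+ 1)) (n×1≡+n n)

  +n≈0⇒m∣n : ∀ n → + n ≈ + 0 → m ∣ n
  +n≈0⇒m∣n n (congruent m∣n-0) = ≡.subst (m ∣_) (ℕ.+-identityʳ n) (∣⇒∣ᵤ m∣n-0)

module PowerSeries (R : CommutativeRing 0ℓ 0ℓ) where

  private
    module R = CommutativeRing R
    module RP = RingProperties R.ring
    open SetoidReasoning R.setoid
    open CommutativeSemigroupProperties R.+-commutativeSemigroup using () renaming (interchange to +-interchange)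

  Series : Set
  Series = ℕ → R.Carrier

  infix 4 _≈_
  record _≈_ (f g : Series) : Set where
    constructor coeffwise
    field coeff : ∀ n → f n R.≈ g n
  open _≈_ public

  infixl 6 _+_
  infixl 7 _*_
  infix 8 -_

  _+_ : Series → Series → Series
  (f + g) n = f n R.+ g n

  -_ : Series → Series
  (- f) n = R.- f n

  0# : Series
  0# _ = R.0#

  q^_ : ℕ → Series
  (q^ zero) zero = R.1#
  (q^ zero) (suc n) = R.0#
  (q^ suc a) zero = R.0#
  (q^ suc a) (suc n) = (q^ a) n

  1# : Series
  1# = q^ 0

  tail : Series → Series
  tail f n = f (suc n)

  _*_ : Series → Series → Series
  (f * g) zero = f 0 R.* g 0
  (f * g) (suc n) = f 0 R.* g (suc n) R.+ (tail f * g) n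

  private
    *-cong-coeff : ∀ {f f′ g g′} → f ≈ f′ → g ≈ g′ → ∀ n → (f * g) n R.≈ (f′ * g′) n
    *-cong-coeff p q zero = R.*-cong (coeff p 0) (coeff q 0)
    *-cong-coeff p q (suc n) =
      R.+-cong (R.*-cong (coeff p 0) (coeff q (suc n))) (*-cong-coeff (coeffwise (λ m → coeff p (suc m))) q n)

    *-distribʳ-coeff : ∀ f g h n → ((f + g) * h) n R.≈ (f * h) n R.+ (g * h) n
    *-distribʳ-coeff f g h zero = R.distribʳ (h 0) (f 0) (g 0)
    *-distribʳ-coeff f g h (suc n) = begin
      (f 0 R.+ g 0) R.* h (suc n) R.+ ((tail f + tail g) * h) n
        ≈⟨ R.+-cong (R.distribʳ (h (suc n)) (f 0) (g 0)) (*-distribʳ-coeff (tail f) (tail g) h n) ⟩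
      (f 0 R.* h (suc n) R.+ g 0 R.* h (suc n)) R.+ ((tail f * h) n R.+ (tail g * h) n)
        ≈⟨ +-interchange _ _ _ _ ⟩
      (f * h) (suc n) R.+ (g * h) (suc n) ∎

    *-distribˡ-coeff : ∀ h f g n → (h * (f + g)) n R.≈ (h * f) n R.+ (h * g) n
    *-distribˡ-coeff h f g zero = R.distribˡ (h 0) (f 0) (g 0)
    *-distribˡ-coeff h f g (suc n) = begin
      h 0 R.* (f (suc n) R.+ g (suc n)) R.+ (tail h * (f + g)) n
        ≈⟨ R.+-cong (R.distribˡ (h 0) _ _) (*-distribˡ-coeff (tail h) f g n) ⟩
      (h 0 R.* f (suc n) R.+ h 0 R.* g (suc n)) R.+ ((tail h * f) n R.+ (tail h * g) n)
        ≈⟨ +-interchange _ _ _ _ ⟩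
      (h * f) (suc n) R.+ (h * g) (suc n) ∎

    *-zeroˡ-coeff : ∀ g n → (0# * g) n R.≈ R.0#
    *-zeroˡ-coeff g zero = R.zeroˡ (g 0)
    *-zeroˡ-coeff g (suc n) = R.trans (R.+-cong (R.zeroˡ (g (suc n))) (*-zeroˡ-coeff g n)) (R.+-identityˡ R.0#)

    *-identityˡ-coeff : ∀ f n → (1# * f) n R.≈ f n
    *-identityˡ-coeff f zero = R.*-identityˡ (f 0)
    *-identityˡ-coeff f (suc n) =
      R.trans (R.+-cong (R.*-identityˡ (f (suc n))) (*-zeroˡ-coeff f n)) (R.+-identityʳ _)

    *-suc-coeff : ∀ f g n → (f * g) (suc n) R.≈ (f * tail g) n R.+ f (suc n) R.* g 0
    *-suc-coeff f g zero = R.refl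
    *-suc-coeff f g (suc n) = begin
      f 0 R.* g (suc (suc n)) R.+ (tail f * g) (suc n)
        ≈⟨ R.+-congˡ (*-suc-coeff (tail f) g n) ⟩
      f 0 R.* g (suc (suc n)) R.+ ((tail f * tail g) n R.+ f (suc (suc n)) R.* g 0)
        ≈⟨ R.sym (R.+-assoc _ _ _) ⟩
      (f * tail g) (suc n) R.+ f (suc (suc n)) R.* g 0 ∎

    *-comm-coeff : ∀ f g n → (f * g) n R.≈ (g * f) n
    *-comm-coeff f g zero = R.*-comm (f 0) (g 0)
    *-comm-coeff f g (suc n) = begin
      f 0 R.* g (suc n) R.+ (tail f * g) n ≈⟨ R.+-cong (R.*-comm (f 0) _) (*-comm-coeff (tail f) g n) ⟩
      g (suc n) R.* f 0 R.+ (g * tail f) n ≈⟨ R.+-comm _ _ ⟩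
      (g * tail f) n R.+ g (suc n) R.* f 0 ≈⟨ R.sym (*-suc-coeff g f n) ⟩
      (g * f) (suc n) ∎

    scale : R.Carrier → Series → Series
    scale c f n = c R.* f n

    scale-*-coeff : ∀ c f g n → (scale c f * g) n R.≈ c R.* (f * g) n
    scale-*-coeff c f g zero = R.*-assoc c (f 0) (g 0)
    scale-*-coeff c f g (suc n) = begin
      c R.* f 0 R.* g (suc n) R.+ (scale c (tail f) * g) n
        ≈⟨ R.+-cong (R.*-assoc c (f 0) (g (suc n))) (scale-*-coeff c (tail f) g n) ⟩
      c R.* (f 0 R.* g (suc n)) R.+ c R.* (tail f * g) n ≈⟨ R.sym (R.distribˡ c _ _) ⟩
      c R.* (f 0 R.* g (suc n) R.+ (tail f * g) n) ∎

    *-assoc-coeff : ∀ f g h n → ((f * g) * h) n R.≈ (f * (g * h)) n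
    *-assoc-coeff f g h zero = R.*-assoc (f 0) (g 0) (h 0)
    *-assoc-coeff f g h (suc n) = begin
      f 0 R.* g 0 R.* h (suc n) R.+ ((scale (f 0) (tail g) + tail f * g) * h) n
        ≈⟨ R.+-cong (R.*-assoc _ _ _) (*-distribʳ-coeff (scale (f 0) (tail g)) (tail f * g) h n) ⟩
      f 0 R.* (g 0 R.* h (suc n)) R.+ ((scale (f 0) (tail g) * h) n R.+ ((tail f * g) * h) n)
        ≈⟨ R.+-congˡ (R.+-cong (scale-*-coeff (f 0) (tail g) h n) (*-assoc-coeff (tail f) g h n)) ⟩
      f 0 R.* (g 0 R.* h (suc n)) R.+ (f 0 R.* (tail g * h) n R.+ (tail f * (g * h)) n)
        ≈⟨ R.sym (R.+-assoc _ _ _) ⟩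
      (f 0 R.* (g 0 R.* h (suc n)) R.+ f 0 R.* (tail g * h) n) R.+ (tail f * (g * h)) n
        ≈⟨ R.+-congʳ (R.sym (R.distribˡ (f 0) _ _)) ⟩
      (f * (g * h)) (suc n) ∎

  isCommutativeRing : IsCommutativeRing _≈_ _+_ _*_ -_ 0# 1#
  isCommutativeRing = record
    { isRing = record
      { +-isAbelianGroup = record
        { isGroup = record
          { isMonoid = record
            { isSemigroup = record
              { isMagma = record
                { isEquivalence = record
                  { refl = coeffwise (λ n → R.refl)
                  ; sym = λ p → coeffwise (λ n → R.sym (coeff p n))
                  ; trans = λ p q → coeffwise (λ n → R.trans (coeff p n) (coeff q n)) }
                ; ∙-cong = λ p q → coeffwise (λ n → R.+-cong (coeff p n) (coeff q n)) }
              ; assoc = λ f g h → coeffwise (λ n → R.+-assoc (f n) (g n) (h n)) }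
            ; identity = (λ f → coeffwise (λ n → R.+-identityˡ (f n)))
                       , (λ f → coeffwise (λ n → R.+-identityʳ (f n))) }
          ; inverse = (λ f → coeffwise (λ n → R.-‿inverseˡ (f n)))
                    , (λ f → coeffwise (λ n → R.-‿inverseʳ (f n)))
          ; ⁻¹-cong = λ p → coeffwise (λ n → R.-‿cong (coeff p n)) }
        ; comm = λ f g → coeffwise (λ n → R.+-comm (f n) (g n)) }
      ; *-cong = λ p q → coeffwise (*-cong-coeff p q)
      ; *-assoc = λ f g h → coeffwise (*-assoc-coeff f g h)
      ; *-identity = (λ f → coeffwise (*-identityˡ-coeff f))
                   , (λ f → coeffwise (λ n → R.trans (*-comm-coeff f 1# n) (*-identityˡ-coeff f n)))
      ; distrib = (λ h f g → coeffwise (*-distribˡ-coeff h f g))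
                , (λ h f g → coeffwise (*-distribʳ-coeff f g h)) }
    ; *-comm = λ f g → coeffwise (*-comm-coeff f g) }

  series : CommutativeRing 0ℓ 0ℓ
  series = record { isCommutativeRing = isCommutativeRing }

  private
    module S = CommutativeRing series
    module SP = RingProperties S.ring

  shift : ℕ → Series → Series
  shift zero f n = f n
  shift (suc a) f zero = R.0#
  shift (suc a) f (suc n) = shift a f n

  q^-*-coeff : ∀ a f n → (q^ a * f) n R.≈ shift a f n
  q^-*-coeff zero f n = *-identityˡ-coeff f n
  q^-*-coeff (suc a) f zero = R.zeroˡ (f 0)
  q^-*-coeff (suc a) f (suc n) =
    R.trans (R.+-cong (R.zeroˡ (f (suc n))) (q^-*-coeff a f n)) (R.+-identityˡ _)

  private
    shift-q^ : ∀ a c n → shift a (q^ c) n ≡ (q^ (a ℕ.+ c)) n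
    shift-q^ zero c n = ≡.refl
    shift-q^ (suc a) c zero = ≡.refl
    shift-q^ (suc a) c (suc n) = shift-q^ a c n

    shift-below : ∀ a f n → n < a → shift a f n ≡ R.0#
    shift-below (suc a) f zero _ = ≡.refl
    shift-below (suc a) f (suc n) (s≤s n<a) = shift-below a f n n<a

  q^-+ : ∀ a c → q^ (a ℕ.+ c) ≈ q^ a * q^ c
  q^-+ a c = coeffwise (λ n → R.sym (R.trans (q^-*-coeff a (q^ c) n) (R.reflexive (shift-q^ a c n))))

  open SemiringExp S.semiring using (_^_)

  q^-^ : ∀ a n → q^ a ^ n ≈ q^ (a ℕ.* n)
  q^-^ a zero = S.reflexive (≡.cong q^_ (≡.sym (ℕ.*-zeroʳ a)))
  q^-^ a (suc n) = S.trans (S.*-congˡ (q^-^ a n)) (S.trans (S.sym (q^-+ a (a ℕ.* n))) (S.reflexive (≡.cong q^_ (≡.sym (ℕ.*-suc a n)))))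

  infix 4 _≈[_]_
  record _≈[_]_ (f : Series) (K : ℕ) (g : Series) : Set where
    constructor below
    field coeff< : ∀ n → n < K → f n R.≈ g n
  open _≈[_]_ public

  truncate : ∀ {f g K} → f ≈ g → f ≈[ K ] g
  truncate p = below (λ n _ → coeff p n)

  ≈[]-refl : ∀ {f K} → f ≈[ K ] f
  ≈[]-refl = below (λ n _ → R.refl)

  ≈[]-sym : ∀ {f g K} → f ≈[ K ] g → g ≈[ K ] f
  ≈[]-sym p = below (λ n n<K → R.sym (coeff< p n n<K))

  ≈[]-trans : ∀ {f g h K} → f ≈[ K ] g → g ≈[ K ] h → f ≈[ K ] h
  ≈[]-trans p q = below (λ n n<K → R.trans (coeff< p n n<K) (coeff< q n n<K))

  ≈[]-weaken : ∀ {f g K L} → L ≤ K → f ≈[ K ] g → f ≈[ L ] g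
  ≈[]-weaken L≤K p = below (λ n n<L → coeff< p n (ℕ.<-≤-trans n<L L≤K))

  ≈[]-setoid : ℕ → Setoid 0ℓ 0ℓ
  ≈[]-setoid K = record
    { Carrier = Series
    ; _≈_ = _≈[ K ]_
    ; isEquivalence = record { refl = ≈[]-refl ; sym = ≈[]-sym ; trans = ≈[]-trans }
    }

  +-cong[] : ∀ {f f′ g g′ K} → f ≈[ K ] f′ → g ≈[ K ] g′ → f + g ≈[ K ] f′ + g′
  +-cong[] p q = below (λ n n<K → R.+-cong (coeff< p n n<K) (coeff< q n n<K))

  -‿cong[] : ∀ {f g K} → f ≈[ K ] g → - f ≈[ K ] - g
  -‿cong[] p = below (λ n n<K → R.-‿cong (coeff< p n n<K))

  *-cong[] : ∀ {f f′ g g′ K} → f ≈[ K ] f′ → g ≈[ K ] g′ → f * g ≈[ K ] f′ * g′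
  *-cong[] {K = K} p q = below (λ n n<K → go K n n<K (coeff< p) (coeff< q))
    where
    go : ∀ {f f′ g g′} K n → n < K → (∀ m → m < K → f m R.≈ f′ m) → (∀ m → m < K → g m R.≈ g′ m) →
         (f * g) n R.≈ (f′ * g′) n
    go K zero n<K p q = R.*-cong (p 0 n<K) (q 0 n<K)
    go (suc K) (suc n) (s≤s n<K) p q =
      R.+-cong (R.*-cong (p 0 (s≤s z≤n)) (q (suc n) (s≤s n<K)))
               (go K n n<K (λ m m<K → p (suc m) (s≤s m<K)) (λ m m<K → q m (ℕ.m<n⇒m<1+n m<K)))

  q^-*-cong[] : ∀ {f g K} a → f ≈[ K ] g → q^ a * f ≈[ a ℕ.+ K ] q^ a * g
  q^-*-cong[] {f} {g} a p = below (λ n n<a+K →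
    R.trans (q^-*-coeff a f n) (R.trans (go a n n<a+K) (R.sym (q^-*-coeff a g n))))
    where
    go : ∀ a n → n < a ℕ.+ _ → shift a f n R.≈ shift a g n
    go zero n n<K = coeff< p n n<K
    go (suc a) zero _ = R.refl
    go (suc a) (suc n) (s≤s n<a+K) = go a n n<a+K

  q^-*-≈[]-0 : ∀ a f → q^ a * f ≈[ a ] 0#
  q^-*-≈[]-0 a f = below (λ n n<a → R.trans (q^-*-coeff a f n) (R.reflexive (shift-below a f n n<a)))

  1-q^-≈[]-1 : ∀ a → 1# S.- q^ a ≈[ a ] 1#
  1-q^-≈[]-1 a = ≈[]-trans (+-cong[] ≈[]-refl (-‿cong[] q^a≈[]0))
                           (truncate (S.trans (S.+-congˡ (SP.-0#≈0#)) (S.+-identityʳ 1#)))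
    where
    q^a≈[]0 : q^ a ≈[ a ] 0#
    q^a≈[]0 = ≈[]-trans (truncate (S.sym (S.*-identityʳ (q^ a)))) (q^-*-≈[]-0 a 1#)

  shift-≤ᵇ : ∀ a f n → shift a f n ≡ (if a ℕ.≤ᵇ n then f (n ℕ.∸ a) else R.0#)
  shift-≤ᵇ zero f n = ≡.refl
  shift-≤ᵇ (suc a) f zero = ≡.refl
  shift-≤ᵇ (suc zero) f (suc n) = ≡.refl
  shift-≤ᵇ (suc (suc a)) f (suc n) = shift-≤ᵇ (suc a) f n

  SupportedIn : (ℕ → Set) → ℕ → Series → Set
  SupportedIn P K f = ∀ a → a < K → ¬ P a → f a R.≈ R.0#

  supported-resp : ∀ {P K f g} → f ≈[ K ] g → SupportedIn P K f → SupportedIn P K g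
  supported-resp f≈g f∈P a a<K ¬Pa = R.trans (R.sym (coeff< f≈g a a<K)) (f∈P a a<K ¬Pa)

  supported-≈0 : ∀ {P K f} → f ≈ 0# → SupportedIn P K f
  supported-≈0 f≈0 a _ _ = coeff f≈0 a

  +-supported : ∀ {P K f g} → SupportedIn P K f → SupportedIn P K g → SupportedIn P K (f + g)
  +-supported f∈P g∈P a a<K ¬Pa = R.trans (R.+-cong (f∈P a a<K ¬Pa) (g∈P a a<K ¬Pa)) (R.+-identityˡ R.0#)

  -‿supported : ∀ {P K f} → SupportedIn P K f → SupportedIn P K (- f)
  -‿supported f∈P a a<K ¬Pa = R.trans (R.-‿cong (f∈P a a<K ¬Pa)) RP.-0#≈0#

  q^-supported : ∀ {P K a} → P a → SupportedIn P K (q^ a)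
  q^-supported {P} {a = a} Pa n _ ¬Pn = R.reflexive (q^-off a n (λ { ≡.refl → ¬Pn Pa }))
    where
    q^-off : ∀ a n → a ≢ n → (q^ a) n ≡ R.0#
    q^-off zero zero a≢n = contradiction ≡.refl a≢n
    q^-off zero (suc n) _ = ≡.refl
    q^-off (suc a) zero _ = ≡.refl
    q^-off (suc a) (suc n) a≢n = q^-off a n (a≢n ∘ ≡.cong suc)

  private
    convolution-zero : ∀ f g a → (∀ i → i ≤ a → f i R.* g (a ℕ.∸ i) R.≈ R.0#) → (f * g) a R.≈ R.0#
    convolution-zero f g zero terms = terms 0 z≤n
    convolution-zero f g (suc a) terms =
      R.trans (R.+-cong (terms 0 z≤n) (convolution-zero (tail f) g a (λ i i≤a → terms (suc i) (s≤s i≤a))))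
              (R.+-identityˡ R.0#)

  *-supported : ∀ {P Q U : ℕ → Set} {K f g} → Decidable P → Decidable Q → (∀ {i j} → P i → Q j → U (i ℕ.+ j)) →
                SupportedIn P K f → SupportedIn Q K g → SupportedIn U K (f * g)
  *-supported {U = U} {f = f} {g} P? Q? P+Q⊆U f∈P g∈Q a a<K ¬Ua = convolution-zero f g a term
    where
    term : ∀ i → i ≤ a → f i R.* g (a ℕ.∸ i) R.≈ R.0#
    term i i≤a with P? i | Q? (a ℕ.∸ i)
    ... | no ¬Pi | _ = R.trans (R.*-congʳ (f∈P i (ℕ.≤-<-trans i≤a a<K) ¬Pi)) (R.zeroˡ _)
    ... | yes _ | no ¬Qa-i = R.trans (R.*-congˡ (g∈Q (a ℕ.∸ i) (ℕ.≤-<-trans (ℕ.m∸n≤m a i) a<K) ¬Qa-i)) (R.zeroʳ _)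
    ... | yes Pi | yes Qa-i = contradiction (≡.subst U (ℕ.m+[n∸m]≡n i≤a) (P+Q⊆U Pi Qa-i)) ¬Ua

module NatIndexedSum (R : CommutativeRing 0ℓ 0ℓ) where

  open CommutativeRing R
  open CommutativeSemigroupProperties +-commutativeSemigroup using () renaming (interchange to +-interchange)

  ∑< : ℕ → (ℕ → Carrier) → Carrier
  ∑< zero h = 0#
  ∑< (suc L) h = ∑< L h + h L

  ∑<-cong : ∀ L {g h} → (∀ j → g j ≈ h j) → ∑< L g ≈ ∑< L h
  ∑<-cong zero g≈h = refl
  ∑<-cong (suc L) g≈h = +-cong (∑<-cong L g≈h) (g≈h L)

  ∑<-+ : ∀ L g h → ∑< L (λ j → g j + h j) ≈ ∑< L g + ∑< L h
  ∑<-+ zero g h = sym (+-identityˡ 0#)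
  ∑<-+ (suc L) g h = trans (+-congʳ (∑<-+ L g h)) (+-interchange _ _ _ _)

  ∑<-*ˡ : ∀ L c h → ∑< L (λ j → c * h j) ≈ c * ∑< L h
  ∑<-*ˡ zero c h = sym (zeroʳ c)
  ∑<-*ˡ (suc L) c h = trans (+-congʳ (∑<-*ˡ L c h)) (sym (distribˡ c _ _))

  ∑<-extend : ∀ {L L′} h → L ≤ L′ → (∀ j → L ≤ j → h j ≈ 0#) → ∑< L′ h ≈ ∑< L h
  ∑<-extend {L′ = zero} h z≤n h≈0 = refl
  ∑<-extend {L′ = suc L′} h L≤1+L′ h≈0 with ℕ.m≤n⇒m<n∨m≡n L≤1+L′
  ... | inj₂ ≡.refl = refl
  ... | inj₁ (s≤s L≤L′) = trans (+-cong (∑<-extend h L≤L′ h≈0) (h≈0 L′ L≤L′)) (+-identityʳ _)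

module ListProduct (R : CommutativeRing 0ℓ 0ℓ) where

  open CommutativeRing R
  open SemiringExp semiring using (_^_)
  open CommutativeSemiringExp commutativeSemiring using (^-distrib-*)
  open CommutativeSemigroupProperties *-commutativeSemigroup using (interchange)

  ∏ : List ℕ → (ℕ → Carrier) → Carrier
  ∏ [] f = 1#
  ∏ (i ∷ is) f = f i * ∏ is f

  ∏-cong : ∀ is {f g} → (∀ i → f i ≈ g i) → ∏ is f ≈ ∏ is g
  ∏-cong [] f≈g = refl
  ∏-cong (i ∷ is) f≈g = *-cong (f≈g i) (∏-cong is f≈g)

  ∏-map : ∀ h is f → ∏ (map h is) f ≈ ∏ is (f ∘ h)
  ∏-map h [] f = refl
  ∏-map h (i ∷ is) f = *-congˡ (∏-map h is f)

  ∏-++ : ∀ is js f → ∏ (is ++ js) f ≈ ∏ is f * ∏ js f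
  ∏-++ [] js f = sym (*-identityˡ _)
  ∏-++ (i ∷ is) js f = trans (*-congˡ (∏-++ is js f)) (sym (*-assoc _ _ _))

  ∏-concatMap : ∀ h is f → ∏ (concatMap h is) f ≈ ∏ is (λ i → ∏ (h i) f)
  ∏-concatMap h [] f = refl
  ∏-concatMap h (i ∷ is) f = trans (∏-++ (h i) (concatMap h is) f) (*-congˡ (∏-concatMap h is f))

  ∏-replicate : ∀ k i f → ∏ (replicate k i) f ≈ f i ^ k
  ∏-replicate zero i f = refl
  ∏-replicate (suc k) i f = *-congˡ (∏-replicate k i f)

  ∏-* : ∀ is f g → ∏ is (λ i → f i * g i) ≈ ∏ is f * ∏ is g
  ∏-* [] f g = sym (*-identityˡ 1#)
  ∏-* (i ∷ is) f g = trans (*-congˡ (∏-* is f g)) (interchange _ _ _ _)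

  1^n≈1 : ∀ k → 1# ^ k ≈ 1#
  1^n≈1 zero = refl
  1^n≈1 (suc k) = trans (*-identityˡ _) (1^n≈1 k)

  ∏-^ : ∀ is f k → ∏ is (λ i → f i ^ k) ≈ ∏ is f ^ k
  ∏-^ [] f k = sym (1^n≈1 k)
  ∏-^ (i ∷ is) f k = trans (*-congˡ (∏-^ is f k)) (sym (^-distrib-* (f i) (∏ is f) k))

  ∏-upTo-suc : ∀ n f → ∏ (upTo (suc n)) f ≈ ∏ (upTo n) f * f n
  ∏-upTo-suc n f = go id n
    where
    go : ∀ h n → ∏ (applyUpTo h (suc n)) f ≈ ∏ (applyUpTo h n) f * f (h n)
    go h zero = *-comm _ _
    go h (suc n) = trans (*-congˡ (go (h ∘ suc) n)) (sym (*-assoc _ _ _))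

FiveIsZero : CommutativeRing 0ℓ 0ℓ → Set
FiveIsZero R = 5 × 1# ≈ 0#
  where
  open CommutativeRing R
  open SemiringMult semiring using (_×_)

module CharacteristicFive (R : CommutativeRing 0ℓ 0ℓ) (5×1≈0 : FiveIsZero R) where

  open CommutativeRing R
  open SemiringMult semiring using (_×_; ×-congˡ; ×-homo-+; ×1-homo-*)
  open SemiringExp semiring using (_^_; ^-congˡ)
  open MultOptimised +-monoid using () renaming (_×_ to _×′_; ×ᵤ≈× to ×ᵤ≈×′)
  open ListProduct R using (1^n≈1)
  open SetoidReasoning setoid

  frobenius : ∀ x y → (x + y) ^ 5 ≈ x ^ 5 + y ^ 5
  frobenius x y = begin
    (x + y) ^ 5                          ≈⟨ binomial x y ⟩
    x ^ 5 + y ^ 5 + 5 ×′ 1# * middle     ≈⟨ +-congˡ (*-congʳ (sym (×ᵤ≈×′ 5 1#))) ⟩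
    x ^ 5 + y ^ 5 + 5 × 1# * middle      ≈⟨ +-congˡ (trans (*-congʳ 5×1≈0) (zeroˡ middle)) ⟩
    x ^ 5 + y ^ 5 + 0#                   ≈⟨ +-identityʳ _ ⟩
    x ^ 5 + y ^ 5                        ∎
    where
    -- The solver reads its numerals with the optimised multiplication _×′_.
    middle : Carrier
    middle = x * y * (x ^ 3 + 2 ×′ 1# * (x * x * y) + 2 ×′ 1# * (x * y * y) + y ^ 3)
    binomial : ∀ x y → (x + y) ^ 5 ≈
      x ^ 5 + y ^ 5 + 5 ×′ 1# * (x * y * (x ^ 3 + 2 ×′ 1# * (x * x * y) + 2 ×′ 1# * (x * y * y) + y ^ 3))
    binomial = solve 2 (λ x y → (x :+ y) :^ 5 :=
      x :^ 5 :+ y :^ 5 :+ con 5 :* (x :* y :* (x :^ 3 :+ con 2 :* (x :* x :* y) :+ con 2 :* (x :* y :* y) :+ y :^ 3))) refl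
      where open NaturalSolver commutativeSemiring

  [1-z]^5≈1-z^5 : ∀ z → (1# - z) ^ 5 ≈ 1# - z ^ 5
  [1-z]^5≈1-z^5 z = begin
    (1# - z) ^ 5                        ≈⟨ sym (+-identityʳ _) ⟩
    (1# - z) ^ 5 + 0#                   ≈⟨ +-congˡ (sym (-‿inverseʳ (z ^ 5))) ⟩
    (1# - z) ^ 5 + (z ^ 5 - z ^ 5)      ≈⟨ sym (+-assoc _ _ _) ⟩
    (1# - z) ^ 5 + z ^ 5 - z ^ 5        ≈⟨ +-congʳ (sym (frobenius (1# - z) z)) ⟩
    ((1# - z) + z) ^ 5 - z ^ 5          ≈⟨ +-congʳ (^-congˡ 5 1-z+z≈1) ⟩
    1# ^ 5 - z ^ 5                      ≈⟨ +-congʳ (1^n≈1 5) ⟩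
    1# - z ^ 5                          ∎
    where
    1-z+z≈1 : (1# - z) + z ≈ 1#
    1-z+z≈1 = trans (+-assoc 1# (- z) z) (trans (+-congˡ (-‿inverseˡ z)) (+-identityʳ 1#))

  ×1#-mod-5 : ∀ m n → m % 5 ≡ n % 5 → m × 1# ≈ n × 1#
  ×1#-mod-5 m n eq = begin
    m × 1#                          ≈⟨ reduce m ⟩
    (m % 5) × 1#                    ≡⟨ ≡.cong (_× 1#) eq ⟩
    (n % 5) × 1#                    ≈⟨ sym (reduce n) ⟩
    n × 1#                          ∎
    where
    reduce : ∀ m → m × 1# ≈ (m % 5) × 1#
    reduce m = begin
      m × 1#                                  ≈⟨ ×-congˡ (m≡m%n+[m/n]*n m 5) ⟩
      (m % 5 ℕ.+ m / 5 ℕ.* 5) × 1#            ≈⟨ ×-homo-+ 1# (m % 5) (m / 5 ℕ.* 5) ⟩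
      (m % 5) × 1# + (m / 5 ℕ.* 5) × 1#       ≈⟨ +-congˡ (×1-homo-* (m / 5) 5) ⟩
      (m % 5) × 1# + (m / 5) × 1# * 5 × 1#    ≈⟨ +-congˡ (trans (*-congˡ 5×1≈0) (zeroʳ _)) ⟩
      (m % 5) × 1# + 0#                       ≈⟨ +-identityʳ _ ⟩
      (m % 5) × 1#                            ∎

module TriangularExponents where

  open import Data.Nat using (_+_; _*_)

  tri : ℕ → ℕ
  tri zero = 0
  tri (suc u) = suc u + tri u

  -- The triangular number of j - N, extended to j < N by T(-1-u) = T(u).
  jacobiExponent : ℕ → ℕ → ℕ
  jacobiExponent zero j = tri j
  jacobiExponent (suc N) zero = tri N
  jacobiExponent (suc N) (suc j) = jacobiExponent N j

  jacobiExponent-above : ∀ N u → jacobiExponent N (N + u) ≡ tri u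
  jacobiExponent-above zero u = ≡.refl
  jacobiExponent-above (suc N) u = jacobiExponent-above N u

  jacobiExponent-below : ∀ j u → jacobiExponent (suc (j + u)) j ≡ tri u
  jacobiExponent-below zero u = ≡.refl
  jacobiExponent-below (suc j) u = jacobiExponent-below j u

  jacobiExponent-+-* : ∀ N j → jacobiExponent N j + N * j ≡ tri (N ∸ 1) + tri j
  jacobiExponent-+-* zero j = ℕ.+-identityʳ (tri j)
  jacobiExponent-+-* (suc N) zero = ≡.cong (λ t → tri N + t) (ℕ.*-zeroʳ N)
  jacobiExponent-+-* (suc N) (suc j) = begin
    jacobiExponent N j + suc N * suc j          ≡⟨ rearrange₁ (jacobiExponent N j) N j ⟩
    (jacobiExponent N j + N * j) + (N + suc j)  ≡⟨ ≡.cong (_+ (N + suc j)) (jacobiExponent-+-* N j) ⟩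
    (tri (N ∸ 1) + tri j) + (N + suc j)         ≡⟨ rearrange₂ (tri (N ∸ 1)) (tri j) N j ⟩
    (N + tri (N ∸ 1)) + (suc j + tri j)         ≡⟨ ≡.cong (_+ tri (suc j)) (tri-pred N) ⟩
    tri N + tri (suc j)                         ∎
    where
    open ≡.≡-Reasoning
    tri-pred : ∀ N → N + tri (N ∸ 1) ≡ tri N
    tri-pred zero = ≡.refl
    tri-pred (suc N) = ≡.refl
    rearrange₁ : ∀ e N j → e + suc N * suc j ≡ (e + N * j) + (N + suc j)
    rearrange₁ = solve-∀
    rearrange₂ : ∀ a c N j → (a + c) + (N + suc j) ≡ (N + a) + (suc j + c)
    rearrange₂ = solve-∀

  jacobiExponent-zero : ∀ N → N + jacobiExponent N 0 ≡ jacobiExponent (suc N) 0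
  jacobiExponent-zero zero = ≡.refl
  jacobiExponent-zero (suc N) = ≡.refl

  jacobiExponent-suc : ∀ N j → N + jacobiExponent N (suc j) ≡ jacobiExponent N j + suc j
  jacobiExponent-suc N j = ℕ.+-cancelʳ-≡ (N * j) _ _ (begin
    N + e (suc j) + N * j               ≡⟨ rearrange₁ N (e (suc j)) j ⟩
    e (suc j) + N * suc j               ≡⟨ jacobiExponent-+-* N (suc j) ⟩
    tri (N ∸ 1) + (suc j + tri j)       ≡⟨ rearrange₂ (tri (N ∸ 1)) (tri j) j ⟩
    (tri (N ∸ 1) + tri j) + suc j       ≡⟨ ≡.cong (_+ suc j) (≡.sym (jacobiExponent-+-* N j)) ⟩
    (e j + N * j) + suc j               ≡⟨ rearrange₃ (e j) (N * j) j ⟩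
    e j + suc j + N * j                 ∎)
    where
    open ≡.≡-Reasoning
    e = jacobiExponent N
    rearrange₁ : ∀ N x j → N + x + N * j ≡ x + N * suc j
    rearrange₁ = solve-∀
    rearrange₂ : ∀ a c j → a + (suc j + c) ≡ (a + c) + suc j
    rearrange₂ = solve-∀
    rearrange₃ : ∀ x y j → (x + y) + suc j ≡ x + suc j + y
    rearrange₃ = solve-∀

  jacobiExponent-suc′ : ∀ N j → j ≤ N + N → suc N + jacobiExponent N j ≡ jacobiExponent N (suc j) + (N + N ∸ j)
  jacobiExponent-suc′ N j j≤2N = ℕ.+-cancelʳ-≡ (suc j) _ _ (begin
    suc N + e j + suc j                 ≡⟨ ℕ.+-assoc (suc N) (e j) (suc j) ⟩
    suc N + (e j + suc j)               ≡⟨ ≡.cong (λ t → suc N + t) (≡.sym (jacobiExponent-suc N j)) ⟩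
    suc N + (N + e (suc j))             ≡⟨ rearrange₁ N (e (suc j)) ⟩
    e (suc j) + suc (N + N)             ≡⟨ ≡.cong (λ t → e (suc j) + suc t) (≡.sym (ℕ.m+[n∸m]≡n j≤2N)) ⟩
    e (suc j) + suc (j + (N + N ∸ j))   ≡⟨ rearrange₂ (e (suc j)) j (N + N ∸ j) ⟩
    e (suc j) + (N + N ∸ j) + suc j     ∎)
    where
    open ≡.≡-Reasoning
    e = jacobiExponent N
    rearrange₁ : ∀ N a → suc N + (N + a) ≡ a + suc (N + N)
    rearrange₁ = solve-∀
    rearrange₂ : ∀ a j d → a + suc (j + d) ≡ a + d + suc j
    rearrange₂ = solve-∀

  tri-≥ : ∀ u → u ≤ tri u
  tri-≥ zero = z≤n
  tri-≥ (suc u) = ℕ.m≤m+n (suc u) (tri u)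

  jacobiExponent-boundˡ : ∀ N j → N ≤ jacobiExponent N j + suc j
  jacobiExponent-boundˡ zero j = z≤n
  jacobiExponent-boundˡ (suc N) zero = ℕ.≤-trans (ℕ.≤-reflexive (ℕ.+-comm 1 N)) (ℕ.+-monoˡ-≤ 1 (tri-≥ N))
  jacobiExponent-boundˡ (suc N) (suc j) = ℕ.≤-trans (s≤s (jacobiExponent-boundˡ N j)) (ℕ.≤-reflexive (≡.sym (ℕ.+-suc _ (suc j))))

  jacobiExponent-boundʳ : ∀ N j d → j + d ≡ N + N → N ≤ jacobiExponent N j + suc d
  jacobiExponent-boundʳ zero j d eq = z≤n
  jacobiExponent-boundʳ (suc N) zero d eq =
    ℕ.≤-trans (ℕ.≤-trans (ℕ.m≤m+n (suc N) (suc N)) (ℕ.≤-reflexive (≡.sym eq)))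
              (ℕ.≤-trans (ℕ.n≤1+n d) (ℕ.m≤n+m (suc d) (tri N)))
  jacobiExponent-boundʳ (suc N) (suc j) zero eq =
    ℕ.≤-trans (tri-≥ (suc N)) (ℕ.≤-trans (ℕ.≤-reflexive (≡.sym top)) (ℕ.m≤m+n _ 1))
    where
    top : jacobiExponent N j ≡ tri (suc N)
    top = ≡.trans (≡.cong (jacobiExponent N) (ℕ.+-cancelˡ-≡ 1 j (N + suc N) (≡.trans (≡.sym (ℕ.+-identityʳ (suc j))) eq)))
                (jacobiExponent-above N (suc N))
  jacobiExponent-boundʳ (suc N) (suc j) (suc d) eq =
    ℕ.≤-trans (s≤s (jacobiExponent-boundʳ N j d j+d≡2N)) (ℕ.≤-reflexive (≡.sym (ℕ.+-suc _ (suc d))))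
    where
    j+d≡2N : j + d ≡ N + N
    j+d≡2N = ℕ.suc-injective (≡.trans (≡.sym (ℕ.+-suc j d)) (≡.trans (ℕ.suc-injective eq) (ℕ.+-suc N N)))

module FiniteTripleProduct (R : CommutativeRing 0ℓ 0ℓ) (x : CommutativeRing.Carrier R) where

  open CommutativeRing R
  open RingProperties ring using (-‿distribˡ-*; -‿involutive; -‿+-comm; [y-z]x≈yx-zx; x[y-z]≈xy-xz)
  open SemiringExp semiring using (_^_; ^-homo-*; ^-congʳ)
  open CommutativeSemigroupProperties *-commutativeSemigroup using () renaming (x∙yz≈y∙xz to x*yz≈y*xz)
  open SetoidReasoning setoid
  open TriangularExponents
  open NaturalSolver commutativeSemiring using (solve; _:=_; _:+_; _:*_)

  x^-merge : ∀ a b c → a ℕ.+ b ≡ c → x ^ a * x ^ b ≈ x ^ c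
  x^-merge a b c eq = trans (sym (^-homo-* x a b)) (^-congʳ x eq)

  x^-rebalance : ∀ a b c d → a ℕ.+ b ≡ c ℕ.+ d → x ^ a * x ^ b ≈ x ^ c * x ^ d
  x^-rebalance a b c d eq = trans (x^-merge a b _ eq) (sym (x^-merge c d _ ≡.refl))

  qbinom : ℕ → ℕ → Carrier
  qbinom m zero = 1#
  qbinom zero (suc j) = 0#
  qbinom (suc m) (suc j) = qbinom m j + x ^ suc j * qbinom m (suc j)

  qbinom-vanish : ∀ {m j} → m < j → qbinom m j ≈ 0#
  qbinom-vanish {zero} {suc j} _ = refl
  qbinom-vanish {suc m} {suc j} (s≤s m<j) = begin
    qbinom m j + x ^ suc j * qbinom m (suc j)  ≈⟨ +-cong (qbinom-vanish m<j) (*-congˡ (qbinom-vanish (ℕ.m<n⇒m<1+n m<j))) ⟩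
    0# + x ^ suc j * 0#                        ≈⟨ trans (+-identityˡ _) (zeroʳ _) ⟩
    0#                                         ∎

  -- Exponent identities involving m ∸ j only need to hold for j ≤ m, since otherwise [m j] = 0.
  *-qbinom-cong : ∀ m j {u v} → (j ≤ m → u ≈ v) → u * qbinom m j ≈ v * qbinom m j
  *-qbinom-cong m j u≈v with j ℕ.≤? m
  ... | yes j≤m = *-congʳ (u≈v j≤m)
  ... | no j≰m = trans (*-congˡ vanish) (trans (zeroʳ _) (sym (trans (*-congˡ vanish) (zeroʳ _))))
    where vanish = qbinom-vanish (ℕ.≰⇒> j≰m)

  qbinom-pascal : ∀ m j → qbinom (suc m) (suc j) ≈ qbinom m (suc j) + x ^ (m ∸ j) * qbinom m j
  qbinom-pascal zero zero = trans (+-congˡ (zeroʳ _)) (trans (+-identityʳ 1#) (sym (trans (+-identityˡ _) (*-identityˡ 1#))))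
  qbinom-pascal zero (suc j) = trans (+-congˡ (zeroʳ _)) (sym (+-congˡ (zeroʳ _)))
  qbinom-pascal (suc m) zero = begin
    1# + x ^ 1 * qbinom (suc m) 1                    ≈⟨ +-congˡ (*-congˡ (qbinom-pascal m 0)) ⟩
    1# + x ^ 1 * (qbinom m 1 + x ^ m * 1#)           ≈⟨ +-congˡ (distribˡ _ _ _) ⟩
    1# + (x ^ 1 * qbinom m 1 + x ^ 1 * (x ^ m * 1#)) ≈⟨ sym (+-assoc _ _ _) ⟩
    qbinom (suc m) 1 + x ^ 1 * (x ^ m * 1#)          ≈⟨ +-congˡ (sym (*-assoc _ _ _)) ⟩
    qbinom (suc m) 1 + x ^ 1 * x ^ m * 1#            ≈⟨ +-congˡ (*-congʳ (sym (^-homo-* x 1 m))) ⟩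
    qbinom (suc m) 1 + x ^ suc m * qbinom (suc m) 0  ∎
  qbinom-pascal (suc m) (suc j) = begin
    qbinom (suc m) (suc j) + β * qbinom (suc m) (suc (suc j)) ≈⟨ +-cong (qbinom-pascal m j) (*-congˡ (qbinom-pascal m (suc j))) ⟩
    (Q₁ + α * Q₀) + β * (Q₂ + γ * Q₁)                          ≈⟨ regroup₁ Q₁ α Q₀ β Q₂ γ ⟩
    ((Q₁ + β * Q₂) + α * Q₀) + (β * γ) * Q₁
      ≈⟨ +-congˡ (*-qbinom-cong m (suc j) (x^-rebalance (suc (suc j)) (m ∸ suc j) (m ∸ j) (suc j) ∘ exponents)) ⟩
    ((Q₁ + β * Q₂) + α * Q₀) + (α * δ) * Q₁                    ≈⟨ regroup₂ Q₁ β Q₂ α Q₀ δ ⟩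
    (Q₁ + β * Q₂) + α * (Q₀ + δ * Q₁)                          ∎
    where
    Q₀ = qbinom m j
    Q₁ = qbinom m (suc j)
    Q₂ = qbinom m (suc (suc j))
    α = x ^ (m ∸ j)
    β = x ^ suc (suc j)
    γ = x ^ (m ∸ suc j)
    δ = x ^ suc j
    exponents : suc j ≤ m → suc (suc j) ℕ.+ (m ∸ suc j) ≡ (m ∸ j) ℕ.+ suc j
    exponents j<m = ≡.trans (≡.cong suc (ℕ.m+[n∸m]≡n j<m))
                            (≡.sym (≡.trans (ℕ.+-suc (m ∸ j) j) (≡.cong suc (ℕ.m∸n+n≡m (ℕ.<⇒≤ j<m)))))
    regroup₁ : ∀ Q₁ α Q₀ β Q₂ γ →
      (Q₁ + α * Q₀) + β * (Q₂ + γ * Q₁) ≈ ((Q₁ + β * Q₂) + α * Q₀) + (β * γ) * Q₁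
    regroup₁ = solve 6 (λ Q₁ α Q₀ β Q₂ γ →
      ((Q₁ :+ α :* Q₀) :+ β :* (Q₂ :+ γ :* Q₁)) := (((Q₁ :+ β :* Q₂) :+ α :* Q₀) :+ (β :* γ) :* Q₁)) refl
    regroup₂ : ∀ Q₁ β Q₂ α Q₀ δ →
      ((Q₁ + β * Q₂) + α * Q₀) + (α * δ) * Q₁ ≈ (Q₁ + β * Q₂) + α * (Q₀ + δ * Q₁)
    regroup₂ = solve 6 (λ Q₁ β Q₂ α Q₀ δ →
      (((Q₁ :+ β :* Q₂) :+ α :* Q₀) :+ (α :* δ) :* Q₁) := ((Q₁ :+ β :* Q₂) :+ α :* (Q₀ :+ δ :* Q₁))) refl

  qbinom-pascal² : ∀ M i → qbinom (suc (suc M)) (suc (suc i)) ≈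
    (1# + x ^ suc M) * qbinom M (suc i) + x ^ (M ∸ i) * qbinom M i + x ^ suc (suc i) * qbinom M (suc (suc i))
  qbinom-pascal² M i = begin
    qbinom (suc M) (suc i) + β * qbinom (suc M) (suc (suc i)) ≈⟨ +-cong (qbinom-pascal M i) (*-congˡ (qbinom-pascal M (suc i))) ⟩
    (Q₁ + α * Q₀) + β * (Q₂ + γ * Q₁)                          ≈⟨ regroup Q₁ α Q₀ β Q₂ γ ⟩
    (Q₁ + (β * γ) * Q₁) + α * Q₀ + β * Q₂                      ≈⟨ +-congʳ (+-congʳ (+-congˡ (*-qbinom-cong M (suc i) merge))) ⟩
    (Q₁ + x ^ suc M * Q₁) + α * Q₀ + β * Q₂                    ≈⟨ +-congʳ (+-congʳ (+-congʳ (sym (*-identityˡ Q₁)))) ⟩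
    (1# * Q₁ + x ^ suc M * Q₁) + α * Q₀ + β * Q₂               ≈⟨ +-congʳ (+-congʳ (sym (distribʳ Q₁ 1# (x ^ suc M)))) ⟩
    (1# + x ^ suc M) * Q₁ + α * Q₀ + β * Q₂                    ∎
    where
    Q₀ = qbinom M i
    Q₁ = qbinom M (suc i)
    Q₂ = qbinom M (suc (suc i))
    α = x ^ (M ∸ i)
    β = x ^ suc (suc i)
    γ = x ^ (M ∸ suc i)
    merge : suc i ≤ M → β * γ ≈ x ^ suc M
    merge i<M = x^-merge (suc (suc i)) (M ∸ suc i) (suc M) (≡.cong suc (ℕ.m+[n∸m]≡n i<M))
    regroup : ∀ Q₁ α Q₀ β Q₂ γ → (Q₁ + α * Q₀) + β * (Q₂ + γ * Q₁) ≈ (Q₁ + (β * γ) * Q₁) + α * Q₀ + β * Q₂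
    regroup = solve 6 (λ Q₁ α Q₀ β Q₂ γ →
      ((Q₁ :+ α :* Q₀) :+ β :* (Q₂ :+ γ :* Q₁)) := ((Q₁ :+ (β :* γ) :* Q₁) :+ α :* Q₀ :+ β :* Q₂)) refl

  qbinom-pascal²-one : ∀ M → qbinom (suc (suc M)) 1 ≈ (1# + x ^ suc M) * 1# + x ^ 1 * qbinom M 1
  qbinom-pascal²-one M = begin
    1# + x ^ 1 * qbinom (suc M) 1              ≈⟨ +-congˡ (*-congˡ (qbinom-pascal M 0)) ⟩
    1# + x ^ 1 * (qbinom M 1 + x ^ M * 1#)     ≈⟨ regroup 1# (x ^ 1) (qbinom M 1) (x ^ M) ⟩
    (1# + (x ^ 1 * x ^ M) * 1#) + x ^ 1 * qbinom M 1
        ≈⟨ +-congʳ (+-congˡ (*-congʳ (x^-merge 1 M (suc M) ≡.refl))) ⟩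
    (1# + x ^ suc M * 1#) + x ^ 1 * qbinom M 1 ≈⟨ +-congʳ (+-congʳ (sym (*-identityˡ 1#))) ⟩
    (1# * 1# + x ^ suc M * 1#) + x ^ 1 * qbinom M 1 ≈⟨ +-congʳ (sym (distribʳ 1# 1# (x ^ suc M))) ⟩
    (1# + x ^ suc M) * 1# + x ^ 1 * qbinom M 1 ∎
    where
    regroup : ∀ o u Q v → o + u * (Q + v * o) ≈ (o + (u * v) * o) + u * Q
    regroup = solve 4 (λ o u Q v → (o :+ u :* (Q :+ v :* o)) := ((o :+ (u :* v) :* o) :+ u :* Q)) refl

  sign : ℕ → Carrier
  sign zero = 1#
  sign (suc k) = - sign k

  -- The coefficient of z^j in z^N ∏_{n=1}^{N} (1 - z x^n) (1 - z⁻¹ x^(n-1)).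
  tripleCoeff : ℕ → ℕ → Carrier
  tripleCoeff N j = sign (j ℕ.+ N) * (x ^ jacobiExponent N j * qbinom (N ℕ.+ N) j)

  -- (z - x^N) (1 - z x^(N+1)) = factor₀ N + factor₁ N z + factor₂ N z².
  factor₀ factor₁ factor₂ : ℕ → Carrier
  factor₀ N = - (x ^ N)
  factor₁ N = 1# + x ^ suc (N ℕ.+ N)
  factor₂ N = - (x ^ suc N)

  infix 8 z*_
  z*_ : (ℕ → Carrier) → ℕ → Carrier
  (z* h) zero = 0#
  (z* h) (suc j) = h j

  private
    qbinom-2[N+1] : ∀ N j → qbinom (suc N ℕ.+ suc N) j ≡ qbinom (suc (suc (N ℕ.+ N))) j
    qbinom-2[N+1] N j = ≡.cong (λ m → qbinom (suc m) j) (ℕ.+-suc N N)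

    neg-swap : ∀ a b c → (- a) * (b * c) ≈ (- b) * (a * c)
    neg-swap a b c = trans (sym (-‿distribˡ-* a (b * c))) (trans (-‿cong (x*yz≈y*xz a b c)) (-‿distribˡ-* b (a * c)))

    tripleCoeff-suc-0 : ∀ N → tripleCoeff (suc N) 0 ≈ factor₀ N * tripleCoeff N 0 + factor₁ N * 0# + factor₂ N * 0#
    tripleCoeff-suc-0 N = sym (begin
      (- p) * (s * (M₀ * 1#)) + factor₁ N * 0# + factor₂ N * 0#
          ≈⟨ trans (+-cong (trans (+-congˡ (zeroʳ _)) (+-identityʳ _)) (zeroʳ _)) (+-identityʳ _) ⟩
      (- p) * (s * (M₀ * 1#))              ≈⟨ neg-swap p s (M₀ * 1#) ⟩
      (- s) * (p * (M₀ * 1#))              ≈⟨ *-congˡ (sym (*-assoc p M₀ 1#)) ⟩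
      (- s) * ((p * M₀) * 1#)              ≈⟨ *-congˡ (*-congʳ (x^-merge N (jacobiExponent N 0) _ (jacobiExponent-zero N))) ⟩
      tripleCoeff (suc N) 0                ∎)
      where
      p = x ^ N
      s = sign N
      M₀ = x ^ jacobiExponent N 0

    tripleCoeff-suc-1 : ∀ N → tripleCoeff (suc N) 1 ≈ factor₀ N * tripleCoeff N 1 + factor₁ N * tripleCoeff N 0 + factor₂ N * 0#
    tripleCoeff-suc-1 N = sym (begin
      (- p) * ((- s) * (M₁ * Q₁)) + c * (s * (M₀ * 1#)) + factor₂ N * 0#
          ≈⟨ trans (+-congˡ (zeroʳ _)) (+-identityʳ _) ⟩
      (- p) * ((- s) * (M₁ * Q₁)) + c * (s * (M₀ * 1#))
          ≈⟨ +-cong (trans (neg-swap p (- s) (M₁ * Q₁)) (*-congʳ (-‿involutive s))) (x*yz≈y*xz c s (M₀ * 1#)) ⟩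
      s * (p * (M₁ * Q₁)) + s * (c * (M₀ * 1#))         ≈⟨ sym (distribˡ s _ _) ⟩
      s * (p * (M₁ * Q₁) + c * (M₀ * 1#))               ≈⟨ *-congˡ (+-congʳ (sym (*-assoc p M₁ Q₁))) ⟩
      s * ((p * M₁) * Q₁ + c * (M₀ * 1#))
          ≈⟨ *-congˡ (+-congʳ (*-congʳ (x^-rebalance N _ _ 1 (jacobiExponent-suc N 0)))) ⟩
      s * ((M₀ * x ^ 1) * Q₁ + c * (M₀ * 1#))           ≈⟨ *-congˡ (regroup M₀ (x ^ 1) Q₁ c 1#) ⟩
      s * (M₀ * (c * 1# + x ^ 1 * Q₁))
          ≈⟨ *-cong (sym (-‿involutive s)) (*-congˡ (sym (qbinom-pascal²-one (N ℕ.+ N)))) ⟩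
      (- - s) * (M₀ * qbinom (suc (suc (N ℕ.+ N))) 1)   ≈⟨ *-congˡ (*-congˡ (reflexive (≡.sym (qbinom-2[N+1] N 1)))) ⟩
      tripleCoeff (suc N) 1                             ∎)
      where
      p = x ^ N
      s = sign N
      c = factor₁ N
      M₀ = x ^ jacobiExponent N 0
      M₁ = x ^ jacobiExponent N 1
      Q₁ = qbinom (N ℕ.+ N) 1
      regroup : ∀ M₀ u Q₁ c o → (M₀ * u) * Q₁ + c * (M₀ * o) ≈ M₀ * (c * o + u * Q₁)
      regroup = solve 5 (λ M₀ u Q₁ c o → ((M₀ :* u) :* Q₁ :+ c :* (M₀ :* o)) := (M₀ :* (c :* o :+ u :* Q₁))) refl

    tripleCoeff-suc-2 : ∀ N i → tripleCoeff (suc N) (suc (suc i)) ≈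
      factor₀ N * tripleCoeff N (suc (suc i)) + factor₁ N * tripleCoeff N (suc i) + factor₂ N * tripleCoeff N i
    tripleCoeff-suc-2 N i = sym (begin
      (- p) * ((- - s) * (M₂ * Q₂)) + c * ((- s) * (M₁ * Q₁)) + (- p′) * (s * (M₀ * Q₀))
          ≈⟨ +-cong (+-cong (trans (*-congˡ (*-congʳ (-‿involutive s))) (neg-swap p s _)) (x*yz≈y*xz c (- s) _)) (neg-swap p′ s _) ⟩
      (- s) * (p * (M₂ * Q₂)) + (- s) * (c * (M₁ * Q₁)) + (- s) * (p′ * (M₀ * Q₀))
          ≈⟨ trans (+-congʳ (sym (distribˡ (- s) _ _))) (sym (distribˡ (- s) _ _)) ⟩
      (- s) * (p * (M₂ * Q₂) + c * (M₁ * Q₁) + p′ * (M₀ * Q₀))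
          ≈⟨ *-congˡ (+-cong (+-congʳ (trans (sym (*-assoc p M₂ Q₂)) (*-congʳ shift₂)))
                             (trans (sym (*-assoc p′ M₀ Q₀)) shift₀)) ⟩
      (- s) * ((M₁ * u) * Q₂ + c * (M₁ * Q₁) + (M₁ * v) * Q₀)
          ≈⟨ *-congˡ (regroup M₁ u Q₂ c Q₁ v Q₀) ⟩
      (- s) * (M₁ * (c * Q₁ + v * Q₀ + u * Q₂))
          ≈⟨ *-congˡ (*-congˡ (sym (qbinom-pascal² (N ℕ.+ N) i))) ⟩
      (- s) * (M₁ * qbinom (suc (suc (N ℕ.+ N))) (suc (suc i)))
          ≈⟨ *-cong (sym (-‿involutive (- s))) (*-congˡ (reflexive (≡.sym (qbinom-2[N+1] N (suc (suc i)))))) ⟩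
      (- - (- s)) * (M₁ * qbinom (suc N ℕ.+ suc N) (suc (suc i)))
          ≈⟨ *-congʳ (reflexive (≡.cong (λ k → - - sign k) (≡.sym (ℕ.+-suc i N)))) ⟩
      tripleCoeff (suc N) (suc (suc i)) ∎)
      where
      p = x ^ N
      p′ = x ^ suc N
      s = sign (i ℕ.+ N)
      c = factor₁ N
      u = x ^ suc (suc i)
      v = x ^ (N ℕ.+ N ∸ i)
      M₀ = x ^ jacobiExponent N i
      M₁ = x ^ jacobiExponent N (suc i)
      M₂ = x ^ jacobiExponent N (suc (suc i))
      Q₀ = qbinom (N ℕ.+ N) i
      Q₁ = qbinom (N ℕ.+ N) (suc i)
      Q₂ = qbinom (N ℕ.+ N) (suc (suc i))
      shift₂ : p * M₂ ≈ M₁ * u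
      shift₂ = x^-rebalance N _ _ (suc (suc i)) (jacobiExponent-suc N (suc i))
      shift₀ : (p′ * M₀) * Q₀ ≈ (M₁ * v) * Q₀
      shift₀ = *-qbinom-cong (N ℕ.+ N) i (λ i≤2N → x^-rebalance (suc N) _ _ (N ℕ.+ N ∸ i) (jacobiExponent-suc′ N i i≤2N))
      regroup : ∀ M₁ u Q₂ c Q₁ v Q₀ →
        (M₁ * u) * Q₂ + c * (M₁ * Q₁) + (M₁ * v) * Q₀ ≈ M₁ * (c * Q₁ + v * Q₀ + u * Q₂)
      regroup = solve 7 (λ M₁ u Q₂ c Q₁ v Q₀ →
        ((M₁ :* u) :* Q₂ :+ c :* (M₁ :* Q₁) :+ (M₁ :* v) :* Q₀) := (M₁ :* (c :* Q₁ :+ v :* Q₀ :+ u :* Q₂))) refl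

  tripleCoeff-suc : ∀ N j → tripleCoeff (suc N) j ≈
    factor₀ N * tripleCoeff N j + factor₁ N * (z* tripleCoeff N) j + factor₂ N * (z* z* tripleCoeff N) j
  tripleCoeff-suc N zero = tripleCoeff-suc-0 N
  tripleCoeff-suc N (suc zero) = tripleCoeff-suc-1 N
  tripleCoeff-suc N (suc (suc i)) = tripleCoeff-suc-2 N i

  tripleCoeff-vanish : ∀ N j → suc (N ℕ.+ N) ≤ j → tripleCoeff N j ≈ 0#
  tripleCoeff-vanish N j 2N<j = trans (*-congˡ (trans (*-congˡ (qbinom-vanish 2N<j)) (zeroʳ _))) (zeroʳ _)

  open NatIndexedSum R
  open SemiringMult semiring using (_×_)
  open CommutativeSemigroupProperties +-commutativeSemigroup using () renaming (interchange to +-interchange)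

  -- P N (1) and P′ N (1) for P N (z) = ∑ⱼ tripleCoeff N j zʲ.
  value slope : ℕ → Carrier
  value N = ∑< (suc (N ℕ.+ N)) (tripleCoeff N)
  slope N = ∑< (suc (N ℕ.+ N)) (λ j → j × 1# * tripleCoeff N j)

  private
    2N<2N+2 : ∀ N → suc (N ℕ.+ N) ≤ N ℕ.+ suc N
    2N<2N+2 N = ℕ.≤-reflexive (≡.sym (ℕ.+-suc N N))

    value-extend : ∀ N {L} → suc (N ℕ.+ N) ≤ L → ∑< L (tripleCoeff N) ≈ value N
    value-extend N le = ∑<-extend (tripleCoeff N) le (tripleCoeff-vanish N)

    slope-extend : ∀ N {L} → suc (N ℕ.+ N) ≤ L → ∑< L (λ j → j × 1# * tripleCoeff N j) ≈ slope N
    slope-extend N le = ∑<-extend _ le (λ j 2N<j → trans (*-congˡ (tripleCoeff-vanish N j 2N<j)) (zeroʳ _))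

    ∑<-z* : ∀ L h → ∑< (suc L) (z* h) ≈ ∑< L h
    ∑<-z* zero h = +-identityˡ 0#
    ∑<-z* (suc L) h = +-congʳ (∑<-z* L h)

    ∑<-×-z* : ∀ L h → ∑< (suc L) (λ j → j × 1# * (z* h) j) ≈ ∑< L h + ∑< L (λ j → j × 1# * h j)
    ∑<-×-z* zero h = +-congˡ (zeroʳ _)
    ∑<-×-z* (suc L) h = begin
      ∑< (suc L) (λ j → j × 1# * (z* h) j) + (1# + L × 1#) * h L
        ≈⟨ +-cong (∑<-×-z* L h) (trans (distribʳ (h L) 1# (L × 1#)) (+-congʳ (*-identityˡ (h L)))) ⟩
      (∑< L h + ∑< L (λ j → j × 1# * h j)) + (h L + L × 1# * h L)
        ≈⟨ +-interchange _ _ _ _ ⟩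
      ∑< (suc L) h + ∑< (suc L) (λ j → j × 1# * h j) ∎

    ∑<-linear₃ : ∀ L a b c f g h → ∑< L (λ j → a * f j + b * g j + c * h j) ≈ a * ∑< L f + b * ∑< L g + c * ∑< L h
    ∑<-linear₃ L a b c f g h = begin
      ∑< L (λ j → a * f j + b * g j + c * h j)                    ≈⟨ ∑<-+ L _ _ ⟩
      ∑< L (λ j → a * f j + b * g j) + ∑< L (λ j → c * h j)       ≈⟨ +-cong (∑<-+ L _ _) (∑<-*ˡ L c h) ⟩
      ∑< L (λ j → a * f j) + ∑< L (λ j → b * g j) + c * ∑< L h    ≈⟨ +-congʳ (+-cong (∑<-*ˡ L a f) (∑<-*ˡ L b g)) ⟩
      a * ∑< L f + b * ∑< L g + c * ∑< L h                        ∎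

  value-suc : ∀ N → value (suc N) ≈ (factor₀ N + factor₁ N + factor₂ N) * value N
  value-suc N = begin
    ∑< L (tripleCoeff (suc N))                                                  ≈⟨ ∑<-cong L (tripleCoeff-suc N) ⟩
    ∑< L (λ j → factor₀ N * A j + factor₁ N * (z* A) j + factor₂ N * (z* z* A) j)
      ≈⟨ ∑<-linear₃ L (factor₀ N) (factor₁ N) (factor₂ N) A (z* A) (z* z* A) ⟩
    factor₀ N * ∑< L A + factor₁ N * ∑< L (z* A) + factor₂ N * ∑< L (z* z* A)
      ≈⟨ +-cong (+-cong (*-congˡ (value-extend N (ℕ.m≤n⇒m≤1+n (ℕ.m≤n⇒m≤1+n (2N<2N+2 N)))))
                        (*-congˡ (trans (∑<-z* (suc N ℕ.+ suc N) A) (value-extend N (ℕ.m≤n⇒m≤1+n (2N<2N+2 N))))))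
                (*-congˡ (trans (∑<-z* (suc N ℕ.+ suc N) (z* A)) (trans (∑<-z* (N ℕ.+ suc N) A) (value-extend N (2N<2N+2 N))))) ⟩
    factor₀ N * value N + factor₁ N * value N + factor₂ N * value N
      ≈⟨ trans (+-congʳ (sym (distribʳ _ _ _))) (sym (distribʳ _ _ _)) ⟩
    (factor₀ N + factor₁ N + factor₂ N) * value N                               ∎
    where
    L = suc (suc N ℕ.+ suc N)
    A = tripleCoeff N

  slope-suc : ∀ N → slope (suc N) ≈
    (factor₀ N + factor₁ N + factor₂ N) * slope N + (factor₁ N + (factor₂ N + factor₂ N)) * value N
  slope-suc N = begin
    ∑< L (λ j → w j * tripleCoeff (suc N) j)
      ≈⟨ ∑<-cong L (λ j → trans (*-congˡ (tripleCoeff-suc N j)) (distribute (w j) f₀ f₁ f₂ (A j) ((z* A) j) ((z* z* A) j))) ⟩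
    ∑< L (λ j → f₀ * (w j * A j) + f₁ * (w j * (z* A) j) + f₂ * (w j * (z* z* A) j))
      ≈⟨ ∑<-linear₃ L f₀ f₁ f₂ (λ j → w j * A j) (λ j → w j * (z* A) j) (λ j → w j * (z* z* A) j) ⟩
    f₀ * ∑< L (λ j → w j * A j) + f₁ * ∑< L (λ j → w j * (z* A) j) + f₂ * ∑< L (λ j → w j * (z* z* A) j)
      ≈⟨ +-cong (+-cong (*-congˡ (slope-extend N (ℕ.m≤n⇒m≤1+n (ℕ.m≤n⇒m≤1+n (2N<2N+2 N))))) (*-congˡ shifted₁))
                (*-congˡ shifted₂) ⟩
    f₀ * slope N + f₁ * (value N + slope N) + f₂ * (value N + (value N + slope N))
      ≈⟨ collect f₀ f₁ f₂ (value N) (slope N) ⟩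
    (f₀ + f₁ + f₂) * slope N + (f₁ + (f₂ + f₂)) * value N ∎
    where
    L = suc (suc N ℕ.+ suc N)
    A = tripleCoeff N
    f₀ = factor₀ N
    f₁ = factor₁ N
    f₂ = factor₂ N
    w : ℕ → Carrier
    w j = j × 1#
    shifted₁ : ∑< L (λ j → w j * (z* A) j) ≈ value N + slope N
    shifted₁ = trans (∑<-×-z* (suc N ℕ.+ suc N) A)
                     (+-cong (value-extend N (ℕ.m≤n⇒m≤1+n (2N<2N+2 N))) (slope-extend N (ℕ.m≤n⇒m≤1+n (2N<2N+2 N))))
    shifted₂ : ∑< L (λ j → w j * (z* z* A) j) ≈ value N + (value N + slope N)
    shifted₂ = trans (∑<-×-z* (suc N ℕ.+ suc N) (z* A))
                     (+-cong (trans (∑<-z* (N ℕ.+ suc N) A) (value-extend N (2N<2N+2 N)))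
                             (trans (∑<-×-z* (N ℕ.+ suc N) A) (+-cong (value-extend N (2N<2N+2 N)) (slope-extend N (2N<2N+2 N)))))
    distribute : ∀ w a b c f g h → w * (a * f + b * g + c * h) ≈ a * (w * f) + b * (w * g) + c * (w * h)
    distribute = solve 7 (λ w a b c f g h → (w :* (a :* f :+ b :* g :+ c :* h)) := (a :* (w :* f) :+ b :* (w :* g) :+ c :* (w :* h))) refl
    collect : ∀ a b c v s → a * s + b * (v + s) + c * (v + (v + s)) ≈ (a + b + c) * s + (b + (c + c)) * v
    collect = solve 5 (λ a b c v s → (a :* s :+ b :* (v :+ s) :+ c :* (v :+ (v :+ s))) := ((a :+ b :+ c) :* s :+ (b :+ (c :+ c)) :* v)) refl

  factor-sum : ∀ N → factor₀ N + factor₁ N + factor₂ N ≈ (1# - x ^ N) * (1# - x ^ suc N)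
  factor-sum N = sym (begin
    (1# - u) * (1# - v)              ≈⟨ [y-z]x≈yx-zx (1# - v) 1# u ⟩
    1# * (1# - v) - u * (1# - v)     ≈⟨ +-cong (*-identityˡ _) (-‿cong (x[y-z]≈xy-xz u 1# v)) ⟩
    (1# - v) - (u * 1# - u * v)      ≈⟨ +-congˡ (trans (sym (-‿+-comm _ _)) (+-cong (-‿cong (*-identityʳ u)) (-‿involutive _))) ⟩
    (1# - v) + (- u + u * v)         ≈⟨ regroup 1# (- u) (- v) (u * v) ⟩
    - u + (1# + u * v) + - v         ≈⟨ +-congʳ (+-congˡ (+-congˡ (x^-merge N (suc N) (suc (N ℕ.+ N)) (ℕ.+-suc N N)))) ⟩
    factor₀ N + factor₁ N + factor₂ N ∎)
    where
    u = x ^ N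
    v = x ^ suc N
    regroup : ∀ o na nb ab → (o + nb) + (na + ab) ≈ na + (o + ab) + nb
    regroup = solve 4 (λ o na nb ab → ((o :+ nb) :+ (na :+ ab)) := (na :+ (o :+ ab) :+ nb)) refl

  value-vanish : ∀ N → value (suc N) ≈ 0#
  value-vanish zero = begin
    value 1                                          ≈⟨ value-suc 0 ⟩
    (factor₀ 0 + factor₁ 0 + factor₂ 0) * value 0    ≈⟨ *-congʳ (factor-sum 0) ⟩
    (1# - 1#) * (1# - x ^ 1) * value 0               ≈⟨ *-congʳ (*-congʳ (-‿inverseʳ 1#)) ⟩
    0# * (1# - x ^ 1) * value 0                      ≈⟨ trans (*-congʳ (zeroˡ _)) (zeroˡ _) ⟩
    0#                                               ∎
  value-vanish (suc N) = trans (value-suc (suc N)) (trans (*-congˡ (value-vanish N)) (zeroʳ _))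

  poch : ℕ → Carrier
  poch zero = 1#
  poch (suc N) = poch N * (1# - x ^ suc N)

  slope-poch : ∀ N → slope (suc N) ≈ poch (suc N) * poch N
  slope-poch zero = begin
    slope 1                                                          ≈⟨ slope-suc 0 ⟩
    (factor₀ 0 + factor₁ 0 + factor₂ 0) * slope 0 + (factor₁ 0 + (factor₂ 0 + factor₂ 0)) * value 0
      ≈⟨ +-cong (trans (*-congˡ slope0) (zeroʳ _)) (*-cong first value0) ⟩
    0# + (1# - x ^ 1) * 1#                                           ≈⟨ trans (+-identityˡ _) (*-congʳ (sym (*-identityˡ _))) ⟩
    poch 1 * poch 0                                                  ∎
    where
    slope0 : slope 0 ≈ 0#
    slope0 = trans (+-identityˡ _) (zeroˡ _)
    value0 : value 0 ≈ 1#
    value0 = trans (+-identityˡ _) (trans (*-identityˡ _) (*-identityˡ _))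
    first : factor₁ 0 + (factor₂ 0 + factor₂ 0) ≈ 1# - x ^ 1
    first = begin
      (1# + y) + (- y + - y)    ≈⟨ sym (+-assoc _ _ _) ⟩
      ((1# + y) + - y) + - y    ≈⟨ +-congʳ (trans (+-assoc _ _ _) (trans (+-congˡ (-‿inverseʳ y)) (+-identityʳ 1#))) ⟩
      1# - y                    ∎
      where y = x ^ suc (0 ℕ.+ 0)
  slope-poch (suc N) = begin
    slope (suc (suc N))                                       ≈⟨ slope-suc (suc N) ⟩
    fsum * slope (suc N) + _ * value (suc N)
      ≈⟨ +-cong (*-cong (factor-sum (suc N)) (slope-poch N)) (trans (*-congˡ (value-vanish N)) (zeroʳ _)) ⟩
    (u * v) * (poch N * u * poch N) + 0#                      ≈⟨ trans (+-identityʳ _) (regroup u v (poch N)) ⟩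
    poch N * u * v * (poch N * u)                             ∎
    where
    fsum = factor₀ (suc N) + factor₁ (suc N) + factor₂ (suc N)
    u = 1# - x ^ suc N
    v = 1# - x ^ suc (suc N)
    regroup : ∀ u v P → (u * v) * (P * u * P) ≈ P * u * v * (P * u)
    regroup = solve 3 (λ u v P → ((u :* v) :* (P :* u :* P)) := (P :* u :* v :* (P :* u))) refl

  weighted-sum : ∀ N c → ∑< (suc (suc N ℕ.+ suc N)) (λ j → (j × 1# - c) * tripleCoeff (suc N) j) ≈ poch (suc N) * poch N
  weighted-sum N c = begin
    ∑< L (λ j → (j × 1# - c) * A j)                   ≈⟨ ∑<-cong L (λ j → distribʳ (A j) (j × 1#) (- c)) ⟩
    ∑< L (λ j → j × 1# * A j + - c * A j)             ≈⟨ ∑<-+ L (λ j → j × 1# * A j) (λ j → - c * A j) ⟩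
    slope (suc N) + ∑< L (λ j → - c * A j)
      ≈⟨ +-cong (slope-poch N) (trans (∑<-*ˡ L (- c) A) (trans (*-congˡ (value-vanish N)) (zeroʳ _))) ⟩
    poch (suc N) * poch N + 0#                        ≈⟨ +-identityʳ _ ⟩
    poch (suc N) * poch N                             ∎
    where
    L = suc (suc N ℕ.+ suc N)
    A = tripleCoeff (suc N)

module TruncatedJacobi (R : CommutativeRing 0ℓ 0ℓ) (b : ℕ) where

  open PowerSeries R using (Series; series; q^_; q^-^; _≈[_]_; ≈[]-setoid; truncate; ≈[]-refl; ≈[]-sym; ≈[]-trans; ≈[]-weaken;
                            +-cong[]; *-cong[]; q^-*-cong[]; q^-*-≈[]-0; 1-q^-≈[]-1)
  open CommutativeRing series
  open SemiringExp semiring using (_^_)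
  open SemiringMult semiring using (_×_)
  open RingProperties ring using ([y-z]x≈yx-zx)
  open TriangularExponents
  open NatIndexedSum series
  open FiniteTripleProduct series (q^ b)

  private
    b*-distrib : ∀ m n → b ℕ.* (m ℕ.+ n) ≡ b ℕ.* m ℕ.+ b ℕ.* n
    b*-distrib = ℕ.*-distribˡ-+ b

  x^-*-≈[]-0 : ∀ n f → q^ b ^ n * f ≈[ b ℕ.* n ] 0#
  x^-*-≈[]-0 n f = ≈[]-trans (truncate (*-congʳ (q^-^ b n))) (q^-*-≈[]-0 (b ℕ.* n) f)

  x^-*-cong[] : ∀ n {f g K} → f ≈[ K ] g → q^ b ^ n * f ≈[ b ℕ.* n ℕ.+ K ] q^ b ^ n * g
  x^-*-cong[] n f≈g = ≈[]-trans (truncate (*-congʳ (q^-^ b n)))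
                                (≈[]-trans (q^-*-cong[] (b ℕ.* n) f≈g) (truncate (*-congʳ (sym (q^-^ b n)))))

  1-x^-≈[]-1 : ∀ n → 1# - q^ b ^ n ≈[ b ℕ.* n ] 1#
  1-x^-≈[]-1 n = ≈[]-trans (truncate (+-congˡ (-‿cong (q^-^ b n)))) (1-q^-≈[]-1 (b ℕ.* n))

  poch*qbinom≈[]1 : ∀ j d → poch j * qbinom (d ℕ.+ j) j ≈[ b ℕ.* suc d ] 1#
  poch*qbinom≈[]1 zero d = truncate (*-identityˡ 1#)
  poch*qbinom≈[]1 (suc j) d rewrite ℕ.+-suc d j =
    ≈[]-trans (truncate (*-assoc (poch j) (1# - u) X))
              (≈[]-trans (≈[]-weaken b[d+1]≤K (*-cong[] ≈[]-refl [1-u]X≈[]prev)) (poch*qbinom≈[]1 j d))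
    where
    m = d ℕ.+ j
    X = qbinom (suc m) (suc j)
    u = q^ b ^ suc j
    K = b ℕ.* suc j ℕ.+ b ℕ.* d
    X≈[]next : X ≈[ b ℕ.* d ] qbinom m (suc j)
    X≈[]next = ≈[]-trans (truncate (trans (qbinom-pascal m j) (+-congˡ (*-congʳ (reflexive (≡.cong (q^ b ^_) (ℕ.m+n∸n≡m d j)))))))
                         (≈[]-trans (+-cong[] ≈[]-refl (x^-*-≈[]-0 d (qbinom m j))) (truncate (+-identityʳ _)))
    X≈[]recur : X ≈[ K ] qbinom m j + u * X
    X≈[]recur = +-cong[] ≈[]-refl (x^-*-cong[] (suc j) (≈[]-sym X≈[]next))
    [1-u]X≈[]prev : (1# - u) * X ≈[ K ] qbinom m j
    [1-u]X≈[]prev = ≈[]-trans (truncate (trans ([y-z]x≈yx-zx X 1# u) (+-congʳ (*-identityˡ X))))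
                     (≈[]-trans (+-cong[] X≈[]recur ≈[]-refl)
                     (truncate (trans (+-assoc _ _ _) (trans (+-congˡ (-‿inverseʳ (u * X))) (+-identityʳ _)))))
    b[d+1]≤K : b ℕ.* suc d ≤ K
    b[d+1]≤K = ℕ.≤-trans (ℕ.≤-reflexive (b*-distrib 1 d)) (ℕ.+-monoˡ-≤ (b ℕ.* d) (ℕ.*-monoʳ-≤ b (s≤s z≤n)))

  poch-mono : ∀ j t → poch (j ℕ.+ t) ≈[ b ℕ.* suc j ] poch j
  poch-mono j zero rewrite ℕ.+-identityʳ j = ≈[]-refl
  poch-mono j (suc t) rewrite ℕ.+-suc j t =
    ≈[]-trans (*-cong[] (poch-mono j t) (≈[]-weaken (ℕ.*-monoʳ-≤ b (s≤s (ℕ.m≤m+n j t))) (1-x^-≈[]-1 (suc (j ℕ.+ t)))))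
              (truncate (*-identityʳ (poch j)))

  ∑<-cong[] : ∀ L {g h K} → (∀ j → j < L → g j ≈[ K ] h j) → ∑< L g ≈[ K ] ∑< L h
  ∑<-cong[] zero g≈h = ≈[]-refl
  ∑<-cong[] (suc L) g≈h = +-cong[] (∑<-cong[] L (λ j j<L → g≈h j (ℕ.m<n⇒m<1+n j<L))) (g≈h L ℕ.≤-refl)

  private
    x^e : ℕ → ℕ → Carrier
    x^e N j = q^ b ^ jacobiExponent N j

    x^e*poch*qbinom≈[]x^e : ∀ N j → j ≤ N ℕ.+ N → x^e N j * (poch (N ℕ.+ N) * qbinom (N ℕ.+ N) j) ≈[ b ℕ.* N ] x^e N j
    x^e*poch*qbinom≈[]x^e N j j≤2N = ≈[]-trans (≈[]-weaken (bound (jacobiExponent-boundˡ N j)) (x^-*-cong[] e poch-trunc))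
                      (≈[]-trans (≈[]-weaken (bound (jacobiExponent-boundʳ N j d j+d≡2N)) (x^-*-cong[] e lower))
                                 (truncate (*-identityʳ _)))
      where
      e = jacobiExponent N j
      d = N ℕ.+ N ∸ j
      j+d≡2N : j ℕ.+ d ≡ N ℕ.+ N
      j+d≡2N = ℕ.m+[n∸m]≡n j≤2N
      poch-trunc : poch (N ℕ.+ N) * qbinom (N ℕ.+ N) j ≈[ b ℕ.* suc j ] poch j * qbinom (N ℕ.+ N) j
      poch-trunc = *-cong[] (≈[]-trans (truncate (reflexive (≡.cong poch (≡.sym j+d≡2N)))) (poch-mono j d)) ≈[]-refl
      lower : poch j * qbinom (N ℕ.+ N) j ≈[ b ℕ.* suc d ] 1#
      lower = ≈[]-trans (truncate (reflexive (≡.cong (λ m → poch j * qbinom m j) (≡.trans (≡.sym j+d≡2N) (ℕ.+-comm j d)))))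
                        (poch*qbinom≈[]1 j d)
      bound : ∀ {k} → N ≤ e ℕ.+ suc k → b ℕ.* N ≤ b ℕ.* e ℕ.+ b ℕ.* suc k
      bound {k} le = ℕ.≤-trans (ℕ.*-monoʳ-≤ b le) (ℕ.≤-reflexive (b*-distrib e (suc k)))

  jacobiSum : ℕ → Carrier → Carrier
  jacobiSum N c = ∑< (suc (N ℕ.+ N)) (λ j → (j × 1# - c) * (sign (j ℕ.+ N) * q^ (b ℕ.* jacobiExponent N j)))

  jacobi-truncated : ∀ N c → poch (suc N) ^ 3 ≈[ b ℕ.* suc N ] jacobiSum (suc N) c
  jacobi-truncated N c = begin
    poch N′ ^ 3
      ≈⟨ *-cong[] (≈[]-sym (≈[]-weaken (ℕ.*-monoʳ-≤ b (ℕ.n≤1+n N′)) (poch-mono N′ N′))) (*-cong[] ≈[]-refl poch-step) ⟩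
    F * (poch N′ * poch N)
      ≈⟨ truncate (*-congˡ (sym (weighted-sum N c))) ⟩
    F * ∑< L (λ j → w j * tripleCoeff N′ j)
      ≈⟨ truncate (sym (∑<-*ˡ L F (λ j → w j * tripleCoeff N′ j))) ⟩
    ∑< L (λ j → F * (w j * tripleCoeff N′ j))
      ≈⟨ truncate (∑<-cong L (λ j → regroup F (w j) (sign (j ℕ.+ N′)) (x^e N′ j) (qbinom (N′ ℕ.+ N′) j))) ⟩
    ∑< L (λ j → w j * (sign (j ℕ.+ N′) * (x^e N′ j * (F * qbinom (N′ ℕ.+ N′) j))))
      ≈⟨ ∑<-cong[] L (λ j j<L → *-cong[] ≈[]-refl (*-cong[] ≈[]-refl (x^e*poch*qbinom≈[]x^e N′ j (ℕ.≤-pred j<L)))) ⟩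
    ∑< L (λ j → w j * (sign (j ℕ.+ N′) * x^e N′ j))
      ≈⟨ truncate (∑<-cong L (λ j → *-congˡ (*-congˡ (q^-^ b (jacobiExponent N′ j))))) ⟩
    ∑< L (λ j → w j * (sign (j ℕ.+ N′) * q^ (b ℕ.* jacobiExponent N′ j))) ∎
    where
    open SetoidReasoning (≈[]-setoid (b ℕ.* suc N))
    N′ = suc N
    L = suc (N′ ℕ.+ N′)
    F = poch (N′ ℕ.+ N′)
    w : ℕ → Carrier
    w j = j × 1# - c
    poch-step : poch N′ * 1# ≈[ b ℕ.* N′ ] poch N
    poch-step = ≈[]-trans (truncate (*-identityʳ _)) (≈[]-trans (*-cong[] ≈[]-refl (1-x^-≈[]-1 N′)) (truncate (*-identityʳ _)))
    regroup : ∀ F w s M Q → F * (w * (s * (M * Q))) ≈ w * (s * (M * (F * Q)))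
    regroup = solve 5 (λ F w s M Q → (F :* (w :* (s :* (M :* Q)))) := (w :* (s :* (M :* (F :* Q))))) refl
      where open NaturalSolver commutativeSemiring

module Ways where

  private
    useW-fuel : ∀ w ws f g r → r ≤ f → r ≤ g → useW f (suc w) ws r ≡ useW g (suc w) ws r
    useW-fuel w ws zero zero r _ _ = ≡.refl
    useW-fuel w ws zero (suc g) zero _ _ = ≡.sym (ℕ.+-identityʳ _)
    useW-fuel w ws (suc f) zero zero _ _ = ℕ.+-identityʳ _
    useW-fuel w ws (suc f) (suc g) r r≤f r≤g with suc w ≤ᵇ r
    ... | true = ≡.cong (ways ws r ℕ.+_) (useW-fuel w ws f g (r ∸ suc w) (fuel r≤f) (fuel r≤g))
      where
      fuel : ∀ {r f} → r ≤ suc f → r ∸ suc w ≤ f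
      fuel {zero} _ = z≤n
      fuel {suc r} (s≤s r≤f) = ℕ.≤-trans (ℕ.m∸n≤m r w) r≤f
    ... | false = ≡.refl

  ways-suc : ∀ w ws r → ways (suc w ∷ ws) r ≡
    ways ws r ℕ.+ (if suc w ≤ᵇ r then ways (suc w ∷ ws) (r ∸ suc w) else 0)
  ways-suc w ws zero = ≡.sym (ℕ.+-identityʳ _)
  ways-suc w ws (suc r) with w ℕ.<ᵇ suc r
  ... | true = ≡.cong (ways ws (suc r) ℕ.+_) (useW-fuel w ws r (r ∸ w) (r ∸ w) (ℕ.m∸n≤m r w) ℕ.≤-refl)
  ... | false = ≡.refl

  ways-zero : ∀ ws r → ways (0 ∷ ws) r ≡ ways ws r
  ways-zero ws zero = ≡.refl
  ways-zero ws (suc r) = ≡.refl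

  ways-divisible : ∀ d ws → All (d ∣_) ws → ∀ r → ¬ d ∣ r → ways ws r ≡ 0
  ways-divisible d [] [] zero d∤0 = contradiction (d ∣0) d∤0
  ways-divisible d [] [] (suc r) _ = ≡.refl
  ways-divisible d (zero ∷ ws) (_ ∷ d∣ws) r d∤r = ≡.trans (ways-zero ws r) (ways-divisible d ws d∣ws r d∤r)
  ways-divisible d (suc w ∷ ws) (d∣w ∷ d∣ws) = <-rec _ step
    where
    step : ∀ r → (∀ {s} → s < r → ¬ d ∣ s → ways (suc w ∷ ws) s ≡ 0) → ¬ d ∣ r → ways (suc w ∷ ws) r ≡ 0
    step r rec d∤r rewrite ways-suc w ws r | ways-divisible d ws d∣ws r d∤r with suc w ≤ᵇ r in w≤r
    ... | false = ≡.refl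
    ... | true = rec (smaller w<r) (λ d∣r-w → d∤r (∣m∸n∣n⇒∣m d w<r d∣r-w d∣w))
      where
      w<r : suc w ≤ r
      w<r = ℕ.≤ᵇ⇒≤ (suc w) r (≡.subst T (≡.sym w≤r) _)
      smaller : ∀ {r} → suc w ≤ r → r ∸ suc w < r
      smaller {suc r} _ = s≤s (ℕ.m∸n≤m r w)

module EulerProduct (R : CommutativeRing 0ℓ 0ℓ) where

  private
    module R = CommutativeRing R
  open SemiringMult R.semiring using (×-homo-+) renaming (_×_ to _×ᴿ_)
  open PowerSeries R using (Series; series; q^_; shift; shift-≤ᵇ; q^-*-coeff; coeffwise)
  open CommutativeRing series
  open RingProperties ring using ([y-z]x≈yx-zx)
  open CommutativeSemigroupProperties *-commutativeSemigroup using (xy∙z≈y∙xz)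
  open Ways
  open ListProduct series using (∏)

  waysSeries : List ℕ → Series
  waysSeries ws n = ways ws n ×ᴿ R.1#

  -- A part of size 0 never changes `ways`, so its factor is 1.
  eulerFactor : ℕ → Series
  eulerFactor zero = 1#
  eulerFactor (suc w) = 1# - q^ suc w

  eulerProduct : List ℕ → Series
  eulerProduct ws = ∏ ws eulerFactor

  private
    waysSeries-suc : ∀ w ws → waysSeries (suc w ∷ ws) ≈ waysSeries ws + q^ suc w * waysSeries (suc w ∷ ws)
    waysSeries-suc w ws = coeffwise λ n → R.trans (step n) (R.+-congˡ (R.sym (q^-*-coeff (suc w) G n)))
      where
      G = waysSeries (suc w ∷ ws)
      step : ∀ n → G n R.≈ waysSeries ws n R.+ shift (suc w) G n
      step n rewrite ways-suc w ws n | shift-≤ᵇ (suc w) G n with suc w ≤ᵇ n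
      ... | true = ×-homo-+ R.1# (ways ws n) _
      ... | false = ×-homo-+ R.1# (ways ws n) 0

  eulerFactor-waysSeries : ∀ w ws → eulerFactor w * waysSeries (w ∷ ws) ≈ waysSeries ws
  eulerFactor-waysSeries zero ws = trans (*-identityˡ _) (coeffwise (λ n → R.reflexive (≡.cong (_×ᴿ R.1#) (ways-zero ws n))))
  eulerFactor-waysSeries (suc w) ws = begin
    (1# - q^ suc w) * G                         ≈⟨ [y-z]x≈yx-zx G 1# (q^ suc w) ⟩
    1# * G - q^ suc w * G                       ≈⟨ +-congʳ (trans (*-identityˡ G) (waysSeries-suc w ws)) ⟩
    waysSeries ws + q^ suc w * G - q^ suc w * G ≈⟨ trans (+-assoc _ _ _) (trans (+-congˡ (-‿inverseʳ _)) (+-identityʳ _)) ⟩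
    waysSeries ws                               ∎
    where
    G = waysSeries (suc w ∷ ws)
    open SetoidReasoning setoid

  eulerProduct-waysSeries : ∀ ws → eulerProduct ws * waysSeries ws ≈ 1#
  eulerProduct-waysSeries [] = trans (*-identityˡ _) (coeffwise empty)
    where
    empty : ∀ n → waysSeries [] n R.≈ 1# n
    empty zero = R.+-identityʳ R.1#
    empty (suc n) = R.refl
  eulerProduct-waysSeries (w ∷ ws) = begin
    eulerFactor w * eulerProduct ws * waysSeries (w ∷ ws)   ≈⟨ xy∙z≈y∙xz _ _ _ ⟩
    eulerProduct ws * (eulerFactor w * waysSeries (w ∷ ws)) ≈⟨ *-congˡ (eulerFactor-waysSeries w ws) ⟩
    eulerProduct ws * waysSeries ws                         ≈⟨ eulerProduct-waysSeries ws ⟩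
    1#                                                      ∎
    where open SetoidReasoning setoid

module DoubledResidues where

  open import Data.Nat using (_+_; _*_)

  open TriangularExponents

  record Doubled≤ (c a : ℕ) : Set where
    constructor doubled
    field
      half : ℕ
      half≤c : half ≤ c
      residue : a % 5 ≡ 2 * half % 5

  doubled≤? : ∀ c → Decidable (Doubled≤ c)
  doubled≤? c a = map′ (λ (s , s<1+c , eq) → doubled s (ℕ.≤-pred s<1+c) eq) (λ (doubled s s≤c eq) → s , s≤s s≤c , eq)
                       (ℕ.anyUpTo? (λ s → a % 5 ℕ.≟ 2 * s % 5) (suc c))

  private
    +-cong-mod : ∀ {a a′ b b′} → a % 5 ≡ a′ % 5 → b % 5 ≡ b′ % 5 → (a + b) % 5 ≡ (a′ + b′) % 5
    +-cong-mod {a} {a′} {b} {b′} a≡a′ b≡b′ = ≡.trans (%-distribˡ-+ a b 5)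
      (≡.trans (≡.cong₂ (λ u v → (u + v) % 5) a≡a′ b≡b′) (≡.sym (%-distribˡ-+ a′ b′ 5)))

  +-doubled≤ : ∀ {c c′ a a′} → Doubled≤ c a → Doubled≤ c′ a′ → Doubled≤ (c + c′) (a + a′)
  +-doubled≤ {a = a} {a′} (doubled s s≤c eq) (doubled s′ s′≤c′ eq′) =
    doubled (s + s′) (ℕ.+-mono-≤ s≤c s′≤c′)
            (≡.trans (+-cong-mod {a} {2 * s} {a′} {2 * s′} eq eq′) (≡.cong (_% 5) (≡.sym (ℕ.*-distribˡ-+ 2 s s′))))

  ∣⇒doubled≤0 : ∀ {a} → 5 ∣ a → Doubled≤ 0 a
  ∣⇒doubled≤0 {a} 5∣a = doubled 0 z≤n (n∣m⇒m%n≡0 a 5 5∣a)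

  ¬doubled≤3 : ∀ m → ¬ Doubled≤ 3 (5 * m + 3)
  ¬doubled≤3 m (doubled s s≤3 eq) = excluded s s≤3 (≡.trans (≡.sym 5m+3≡3) eq)
    where
    5m+3≡3 : (5 * m + 3) % 5 ≡ 3
    5m+3≡3 = ≡.trans (≡.cong (_% 5) (rearrange m)) ([m+kn]%n≡m%n 3 m 5)
      where
      rearrange : ∀ m → 5 * m + 3 ≡ 3 + m * 5
      rearrange = solve-∀
    excluded : ∀ s → s ≤ 3 → ¬ 3 ≡ 2 * s % 5
    excluded 0 _ ()
    excluded 1 _ ()
    excluded 2 _ ()
    excluded 3 _ ()
    excluded (suc (suc (suc (suc s)))) (s≤s (s≤s (s≤s ()))) _

  private
    tri-periodic : ∀ r q → tri (r + q * 5) % 5 ≡ tri r % 5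
    tri-periodic r zero = ≡.cong (λ v → tri v % 5) (ℕ.+-identityʳ r)
    tri-periodic r (suc q) = begin
      tri (r + suc q * 5) % 5                 ≡⟨ ≡.cong (λ v → tri v % 5) (rearrange r q) ⟩
      tri (5 + (r + q * 5)) % 5               ≡⟨ ≡.cong (_% 5) (tri-5+ (r + q * 5) (tri (r + q * 5))) ⟩
      (tri (r + q * 5) + (r + q * 5 + 3) * 5) % 5 ≡⟨ [m+kn]%n≡m%n (tri (r + q * 5)) (r + q * 5 + 3) 5 ⟩
      tri (r + q * 5) % 5                     ≡⟨ tri-periodic r q ⟩
      tri r % 5                               ∎
      where
      open ≡.≡-Reasoning
      rearrange : ∀ r q → r + suc q * 5 ≡ 5 + (r + q * 5)
      rearrange = solve-∀
      tri-5+ : ∀ x t → suc (4 + x) + (suc (3 + x) + (suc (2 + x) + (suc (1 + x) + (suc x + t)))) ≡ t + (x + 3) * 5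
      tri-5+ = solve-∀

    tri-%5 : ∀ u → tri u % 5 ≡ tri (u % 5) % 5
    tri-%5 u = ≡.trans (≡.cong (λ v → tri v % 5) (m≡m%n+[m/n]*n u 5)) (tri-periodic (u % 5) (u / 5))

  tri-mod-5 : ∀ u → u % 5 ≡ 2 ⊎ tri u % 5 ≤ 1
  tri-mod-5 u with u % 5 | m%n<n u 5 | tri-%5 u
  ... | 0 | _ | eq = inj₂ (ℕ.≤-trans (ℕ.≤-reflexive eq) z≤n)
  ... | 1 | _ | eq = inj₂ (ℕ.≤-reflexive eq)
  ... | 2 | _ | _ = inj₁ ≡.refl
  ... | 3 | _ | eq = inj₂ (ℕ.≤-reflexive eq)
  ... | 4 | _ | eq = inj₂ (ℕ.≤-trans (ℕ.≤-reflexive eq) z≤n)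
  ... | suc (suc (suc (suc (suc _)))) | s≤s (s≤s (s≤s (s≤s (s≤s ())))) | _

  private
    doubled-tri : ∀ u → tri u % 5 ≤ 1 → Doubled≤ 1 (2 * tri u)
    doubled-tri u t≤1 = doubled (tri u % 5) t≤1 (%-distribˡ-* 2 (tri u) 5)

    jacobi-residue-below : ∀ j u → u % 5 ≡ 2 → j % 5 ≡ (suc (j + u) + 2) % 5
    jacobi-residue-below j u u≡2 = ≡.sym (begin
      (suc (j + u) + 2) % 5   ≡⟨ ≡.cong (_% 5) (rearrange j u) ⟩
      (j + (u + 3)) % 5
        ≡⟨ +-cong-mod {j} {j} {u + 3} {5} ≡.refl (≡.trans (%-distribˡ-+ u 3 5) (≡.cong (λ r → (r + 3) % 5) u≡2)) ⟩
      (j + 5) % 5             ≡⟨ [m+kn]%n≡m%n j 1 5 ⟩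
      j % 5                   ∎)
      where
      open ≡.≡-Reasoning
      rearrange : ∀ j u → suc (j + u) + 2 ≡ j + (u + 3)
      rearrange = solve-∀

  jacobi-residue : ∀ N j → j % 5 ≡ (N + 2) % 5 ⊎ Doubled≤ 1 (2 * jacobiExponent N j)
  jacobi-residue N j with N ℕ.≤? j
  ... | yes N≤j with ℕ.m≤n⇒∃[o]m+o≡n N≤j
  ...   | u , ≡.refl rewrite jacobiExponent-above N u with tri-mod-5 u
  ...     | inj₁ u≡2 = inj₁ (+-cong-mod {N} {N} {u} {2} ≡.refl u≡2)
  ...     | inj₂ t≤1 = inj₂ (doubled-tri u t≤1)
  jacobi-residue N j | no N≰j with ℕ.m≤n⇒∃[o]m+o≡n (ℕ.≰⇒> N≰j)
  ...   | u , ≡.refl rewrite jacobiExponent-below j u with tri-mod-5 u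
  ...     | inj₁ u≡2 = inj₁ (jacobi-residue-below j u u≡2)
  ...     | inj₂ t≤1 = inj₂ (doubled-tri u t≤1)

module ModuloFive where

  ℤ/5ℤ : CommutativeRing 0ℓ 0ℓ
  ℤ/5ℤ = IntegersModulo.ring 5

  open PowerSeries ℤ/5ℤ using (Series; series; q^_; q^-^; coeff; coeffwise; _≈[_]_; truncate; 1-q^-≈[]-1;
                               ≈[]-refl; ≈[]-sym; ≈[]-trans; ≈[]-weaken; *-cong[]; SupportedIn; supported-resp;
                               supported-≈0; +-supported; -‿supported; q^-supported; *-supported)
  open CommutativeRing series
  open SemiringExp semiring using (_^_; ^-assocʳ; ^-congˡ; ^-congʳ)
  open SemiringMult semiring using (_×_)
  open DoubledResidues
  open TriangularExponents
  open NatIndexedSum series using (∑<)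
  open TruncatedJacobi ℤ/5ℤ 2 using (jacobiSum; jacobi-truncated)
  open FiniteTripleProduct series (q^ 2) using (poch; sign)
  open EulerProduct ℤ/5ℤ
  open ListProduct series
  open Ways using (ways-divisible)

  5×1≈0 : 5 × 1# ≈ 0#
  5×1≈0 = coeffwise λ { zero → IntegersModulo.congruent (ℤ∣.divides (+ 1) ≡.refl) ; (suc n) → CommutativeRing.refl ℤ/5ℤ }

  open CharacteristicFive series 5×1≈0

  private
    Constant : ℕ → Series → Set
    Constant = SupportedIn (_≡ 0)

    1#-constant : ∀ {K} → Constant K 1#
    1#-constant = q^-supported ≡.refl

    ×1#-constant : ∀ {K} n → Constant K (n × 1#)
    ×1#-constant zero = supported-≈0 refl
    ×1#-constant (suc n) = +-supported 1#-constant (×1#-constant n)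

    sign-constant : ∀ {K} k → Constant K (sign k)
    sign-constant zero = 1#-constant
    sign-constant (suc k) = -‿supported (sign-constant k)

    constant-* : ∀ {P : ℕ → Set} {K c f} → Decidable P → Constant K c → SupportedIn P K f → SupportedIn P K (c * f)
    constant-* P? = *-supported (ℕ._≟ 0) P? (λ { ≡.refl Pj → Pj })

    ∑<-supported : ∀ {P K} L h → (∀ j → SupportedIn P K (h j)) → SupportedIn P K (∑< L h)
    ∑<-supported zero h h∈P = supported-≈0 refl
    ∑<-supported (suc L) h h∈P = +-supported (∑<-supported L h h∈P) (h∈P L)

  -- Since P_N(1) = 0, any constant c may be subtracted from the weight j; c = N + 2 makes both weights
  -- of the exponent T(u), namely u - 2 and -(u + 3), divisible by 5 exactly when u ≡ 2 (mod 5).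
  jacobiSum-supported : ∀ N K → SupportedIn (Doubled≤ 1) K (jacobiSum N ((N ℕ.+ 2) × 1#))
  jacobiSum-supported N K = ∑<-supported (suc (N ℕ.+ N)) _ term
    where
    term : ∀ j → SupportedIn (Doubled≤ 1) K (((j × 1#) - (N ℕ.+ 2) × 1#) * (sign (j ℕ.+ N) * q^ (2 ℕ.* jacobiExponent N j)))
    term j with jacobi-residue N j
    ... | inj₁ j≡N+2 = supported-≈0
      (trans (*-congʳ (trans (+-congʳ (×1#-mod-5 j (N ℕ.+ 2) j≡N+2)) (-‿inverseʳ ((N ℕ.+ 2) × 1#)))) (zeroˡ _))
    ... | inj₂ twice = constant-* (doubled≤? 1) (+-supported (×1#-constant j) (-‿supported (×1#-constant (N ℕ.+ 2))))
                           (constant-* (doubled≤? 1) (sign-constant (j ℕ.+ N)) (q^-supported {a = 2 ℕ.* jacobiExponent N j} twice))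

  evenFactor : ℕ → Series
  evenFactor y = if suc y % 2 ≡ᵇ 0 then 1# - q^ suc y else 1#

  evenPart : ℕ → Series
  evenPart n = ∏ (upTo n) evenFactor

  evenPart-poch : ∀ N → evenPart (N ℕ.+ N) ≈ poch N
  evenPart-poch zero = refl
  evenPart-poch (suc N) = begin
    evenPart (suc N ℕ.+ suc N)                                           ≡⟨ ≡.cong evenPart (ℕ.+-suc (suc N) N) ⟩
    evenPart (suc (suc (N ℕ.+ N)))
      ≈⟨ trans (∏-upTo-suc (suc (N ℕ.+ N)) evenFactor) (*-congʳ (∏-upTo-suc (N ℕ.+ N) evenFactor)) ⟩
    evenPart (N ℕ.+ N) * evenFactor (N ℕ.+ N) * evenFactor (suc (N ℕ.+ N)) ≈⟨ *-cong (*-cong (evenPart-poch N) odd) even ⟩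
    poch N * 1# * (1# - q^ 2 ^ suc N)                                    ≈⟨ *-congʳ (*-identityʳ _) ⟩
    poch (suc N)                                                         ∎
    where
    open SetoidReasoning setoid
    odd-form : ∀ N → suc (N ℕ.+ N) ≡ 1 ℕ.+ N ℕ.* 2
    odd-form = solve-∀
    even-form : ∀ N → suc (suc (N ℕ.+ N)) ≡ suc N ℕ.* 2
    even-form = solve-∀
    even-form′ : ∀ N → 2 ℕ.* suc N ≡ suc N ℕ.* 2
    even-form′ = solve-∀
    odd : evenFactor (N ℕ.+ N) ≈ 1#
    odd rewrite ≡.trans (≡.cong (_% 2) (odd-form N)) ([m+kn]%n≡m%n 1 N 2) = refl
    even : evenFactor (suc (N ℕ.+ N)) ≈ 1# - q^ 2 ^ suc N
    even rewrite ≡.trans (≡.cong (_% 2) (even-form N)) (m*n%n≡0 (suc N) 2) =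
      +-congˡ {1#} (-‿cong (sym (trans (q^-^ 2 (suc N)) (reflexive (≡.cong q^_ (≡.trans (even-form′ N) (≡.sym (even-form N))))))))

  evenPart-≈[] : ∀ n → evenPart n ≈[ suc n ] poch (suc n)
  evenPart-≈[] n = ≈[]-trans (extend (suc (suc n)))
                             (truncate (trans (reflexive (≡.cong evenPart (ℕ.+-suc n (suc n)))) (evenPart-poch (suc n))))
    where
    evenFactor-≈[]-1 : ∀ y → evenFactor y ≈[ suc y ] 1#
    evenFactor-≈[]-1 y with suc y % 2 ≡ᵇ 0
    ... | true = 1-q^-≈[]-1 (suc y)
    ... | false = ≈[]-refl
    extend : ∀ d → evenPart n ≈[ suc n ] evenPart (n ℕ.+ d)
    extend zero = truncate (reflexive (≡.cong evenPart (≡.sym (ℕ.+-identityʳ n))))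
    extend (suc d) = ≈[]-trans (extend d) (≈[]-trans (truncate (sym (*-identityʳ _)))
      (≈[]-trans (*-cong[] ≈[]-refl (≈[]-sym (≈[]-weaken (s≤s (ℕ.m≤m+n n d)) (evenFactor-≈[]-1 (n ℕ.+ d)))))
                 (truncate (sym (trans (reflexive (≡.cong evenPart (ℕ.+-suc n d))) (∏-upTo-suc (n ℕ.+ d) evenFactor))))))

  block : ℕ → ℕ → List ℕ
  block k i = if i % 2 ≡ᵇ 0 then i ∷ [] else replicate k i

  block₅ : ℕ → ℕ → List ℕ
  block₅ j i = if i % 2 ≡ᵇ 0 then 5 ℕ.* i ∷ 5 ℕ.* i ∷ [] else replicate (suc j) (5 ℕ.* i)

  parts₅ : ℕ → ℕ → List ℕ
  parts₅ j n = concatMap (block₅ j) (map suc (upTo n))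

  private
    eulerProduct-blocks : ∀ blk n → eulerProduct (concatMap blk (map suc (upTo n))) ≈ ∏ (upTo n) (λ y → eulerProduct (blk (suc y)))
    eulerProduct-blocks blk n = trans (∏-concatMap blk (map suc (upTo n)) eulerFactor) (∏-map suc (upTo n) (λ i → eulerProduct (blk i)))

    fifth-power : ∀ i → (1# - q^ i) ^ 5 ≈ 1# - q^ (5 ℕ.* i)
    fifth-power i = trans ([1-z]^5≈1-z^5 (q^ i)) (+-congˡ {1#} (-‿cong (trans (q^-^ i 5) (reflexive (≡.cong q^_ (ℕ.*-comm i 5))))))

  block-step : ∀ j y → eulerProduct (block (5 ℕ.* j ℕ.+ 5) (suc y)) * evenFactor y ^ 9 ≈ eulerProduct (block₅ j (suc y))
  block-step j y with suc y % 2 ≡ᵇ 0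
  ... | true = begin
    φ * 1# * φ ^ 9        ≈⟨ *-congʳ (*-identityʳ φ) ⟩
    φ ^ 10                ≈⟨ sym (^-assocʳ φ 5 2) ⟩
    (φ ^ 5) ^ 2           ≈⟨ ^-congˡ 2 (fifth-power (suc y)) ⟩
    ψ ^ 2                 ∎
    where
    open SetoidReasoning setoid
    φ = 1# - q^ suc y
    ψ = 1# - q^ (5 ℕ.* suc y)
  ... | false = begin
    ∏ (replicate k (suc y)) eulerFactor * 1# ^ 9   ≈⟨ *-cong (∏-replicate k (suc y) eulerFactor) (1^n≈1 9) ⟩
    φ ^ k * 1#                                     ≈⟨ *-identityʳ _ ⟩
    φ ^ k                                          ≈⟨ ^-congʳ φ (k≡5[j+1] j) ⟩
    φ ^ (5 ℕ.* suc j)                              ≈⟨ sym (^-assocʳ φ 5 (suc j)) ⟩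
    (φ ^ 5) ^ suc j                                ≈⟨ ^-congˡ (suc j) (fifth-power (suc y)) ⟩
    ψ ^ suc j                                      ≈⟨ sym (∏-replicate (suc j) (5 ℕ.* suc y) eulerFactor) ⟩
    ∏ (replicate (suc j) (5 ℕ.* suc y)) eulerFactor ∎
    where
    open SetoidReasoning setoid
    k = 5 ℕ.* j ℕ.+ 5
    φ = 1# - q^ suc y
    ψ = 1# - q^ (5 ℕ.* suc y)
    k≡5[j+1] : ∀ j → 5 ℕ.* j ℕ.+ 5 ≡ 5 ℕ.* suc j
    k≡5[j+1] = solve-∀

  kinds-product : ∀ j n → eulerProduct (kinds (5 ℕ.* j ℕ.+ 5) n) * evenPart n ^ 9 ≈ eulerProduct (parts₅ j n)
  kinds-product j n = begin
    eulerProduct (kinds k n) * evenPart n ^ 9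
      ≈⟨ *-cong (eulerProduct-blocks (block k) n) (sym (∏-^ (upTo n) evenFactor 9)) ⟩
    ∏ (upTo n) (λ y → eulerProduct (block k (suc y))) * ∏ (upTo n) (λ y → evenFactor y ^ 9)
      ≈⟨ sym (∏-* (upTo n) _ _) ⟩
    ∏ (upTo n) (λ y → eulerProduct (block k (suc y)) * evenFactor y ^ 9)
      ≈⟨ ∏-cong (upTo n) (block-step j) ⟩
    ∏ (upTo n) (λ y → eulerProduct (block₅ j (suc y)))
      ≈⟨ sym (eulerProduct-blocks (block₅ j) n) ⟩
    eulerProduct (parts₅ j n) ∎
    where
    open SetoidReasoning setoid
    k = 5 ℕ.* j ℕ.+ 5

  private
    cancel-inverse : ∀ {p g e p′ g′} → p * g ≈ 1# → p′ * g′ ≈ 1# → p * e ≈ p′ → g ≈ e * g′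
    cancel-inverse {p} {g} {e} {p′} {g′} pg≈1 p′g′≈1 pe≈p′ = begin
      g                    ≈⟨ sym (*-identityʳ g) ⟩
      g * 1#               ≈⟨ *-congˡ (sym p′g′≈1) ⟩
      g * (p′ * g′)        ≈⟨ *-congˡ (*-congʳ (sym pe≈p′)) ⟩
      g * ((p * e) * g′)   ≈⟨ regroup g p e g′ ⟩
      (p * g) * (e * g′)   ≈⟨ *-congʳ pg≈1 ⟩
      1# * (e * g′)        ≈⟨ *-identityˡ _ ⟩
      e * g′               ∎
      where
      open SetoidReasoning setoid
      regroup : ∀ g p e g′ → g * ((p * e) * g′) ≈ (p * g) * (e * g′)
      regroup = solve 4 (λ g p e g′ → (g :* ((p :* e) :* g′)) := ((p :* g) :* (e :* g′))) refl
        where open NaturalSolver commutativeSemiring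

  waysSeries-kinds : ∀ j n → waysSeries (kinds (5 ℕ.* j ℕ.+ 5) n) ≈ evenPart n ^ 9 * waysSeries (parts₅ j n)
  waysSeries-kinds j n =
    cancel-inverse (eulerProduct-waysSeries (kinds (5 ℕ.* j ℕ.+ 5) n)) (eulerProduct-waysSeries (parts₅ j n)) (kinds-product j n)

  private
    parts₅-divisible : ∀ j n → All (5 ∣_) (parts₅ j n)
    parts₅-divisible j n = concat⁺ (map⁺ (map⁺ (applyUpTo⁺₂ id n (λ y → block₅-divisible (suc y)))))
      where
      block₅-divisible : ∀ i → All (5 ∣_) (block₅ j i)
      block₅-divisible i with i % 2 ≡ᵇ 0
      ... | true = m∣m*n i ∷ m∣m*n i ∷ []
      ... | false = replicate⁺ (suc j) (m∣m*n i)

    parts₅-supported : ∀ j n K → SupportedIn (Doubled≤ 0) K (waysSeries (parts₅ j n))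
    parts₅-supported j n K a _ ¬doubled
      rewrite ways-divisible 5 (parts₅ j n) (parts₅-divisible j n) a (¬doubled ∘ ∣⇒doubled≤0) = CommutativeRing.refl ℤ/5ℤ

    cube-supported : ∀ n → SupportedIn (Doubled≤ 1) (suc n) (evenPart n ^ 3)
    cube-supported n = supported-resp (≈[]-sym truncated) (jacobiSum-supported (suc n) (suc n))
      where
      truncated : evenPart n ^ 3 ≈[ suc n ] jacobiSum (suc n) ((suc n ℕ.+ 2) × 1#)
      truncated = ≈[]-trans (*-cong[] E≈ (*-cong[] E≈ (*-cong[] E≈ ≈[]-refl)))
                            (≈[]-weaken (ℕ.m≤n*m (suc n) 2) (jacobi-truncated n ((suc n ℕ.+ 2) × 1#)))
        where E≈ = evenPart-≈[] n

    ninth-supported : ∀ n → SupportedIn (Doubled≤ 3) (suc n) (evenPart n ^ 9)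
    ninth-supported n = supported-resp (truncate (^-assocʳ (evenPart n) 3 3))
      (*-supported (doubled≤? 1) (doubled≤? 2) +-doubled≤ cube
      (*-supported (doubled≤? 1) (doubled≤? 1) +-doubled≤ cube
      (*-supported (doubled≤? 1) (doubled≤? 0) +-doubled≤ cube (q^-supported {a = 0} (doubled 0 z≤n ≡.refl)))))
      where cube = cube-supported n

  product-supported : ∀ j n → SupportedIn (Doubled≤ 3) (suc n) (evenPart n ^ 9 * waysSeries (parts₅ j n))
  product-supported j n = *-supported (doubled≤? 3) (doubled≤? 0) +-doubled≤ (ninth-supported n) (parts₅-supported j n (suc n))

open import Data.Nat using (_+_; _*_)

corollary3p1 : (j n : ℕ) → 5 ∣ a (5 * j + 5) (5 * n + 3)
corollary3p1 j m = +n≈0⇒m∣n (a k n)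
  (Z.trans (Z.reflexive (≡.sym (n×1≡+n (a k n))))
  (Z.trans (coeff (waysSeries-kinds j n) n)
           (product-supported j n n ℕ.≤-refl (¬doubled≤3 m))))
  where
  open IntegersModulo 5 using (+n≈0⇒m∣n; n×1≡+n)
  open ModuloFive using (ℤ/5ℤ; waysSeries-kinds; product-supported)
  open PowerSeries ℤ/5ℤ using (coeff)
  open DoubledResidues using (¬doubled≤3)
  module Z = CommutativeRing ℤ/5ℤ
  k = 5 * j + 5
  n = 5 * m + 3
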